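{- Let $r\ge 1$ and let $GT(r)$ be the glued binary tree of depth $r$ with quasi-leaves $v_1,\dots,v_{2^r}$. If $S$ is a mutual-visibility set of $GT(r)$, then for all distinct $i,j\in[2^r]$ we have $|S\cap V(C_{i,j})|\le 3$.
   Context: A set $S\subseteq V(G)$ is a mutual-visibility set if for every $x,y\in S$ there is a shortest $x$–$y$ path in $G$ none of whose internal vertices lies in $S$. A perfect binary tree $T_{r,2}$ of depth $r\ge1$ is a rooted tree in which every non-leaf vertex has exactly $2$ children and all leaves have depth $r$. The glued binary tree $GT(r)$ is obtained from two copies $T^{(1)}_r$ and $T^{(2)}_r$ of $T_{r,2}$ by pairwise identifying their leaves (the identification being via the same correspondence of leaves of the two copies, leaves ordered left to right); the identified vertices are the quasi-leaves $v_1,\dots,v_{2^r}$ (labelled left to right). For two distinct quasi-leaves $v_i,v_j$ there are exactly two shortest $v_i$–$v_j$ paths in $GT(r)$, one, $P_{i,j}$, through $T^{(1)}_r$ and the other, $P'_{i,j}$, through $T^{(2)}_r$; $C_{i,j}$ denotes the cycle formed by $P_{i,j}\cup P'_{i,j}$. -}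

module Defs where

open import Data.Nat using (ℕ; zero; suc; _<_; _≤_)
open import Data.Bool using (Bool)
open import Data.Vec using (Vec; []; _∷_; toList)
open import Data.List using (List; []; _∷_; length)
open import Data.List.Membership.Propositional using (_∈_)
open import Data.List.Relation.Unary.All using (All)
open import Data.Product using (Σ; _×_)
open import Relation.Binary.PropositionalEquality using (_≡_)
open import Relation.Nullary using (¬_)

module Graph {V : Set} (Adj : V → V → Set) where

  data Walk : V → V → Set where
    []  : ∀ {x} → Walk x x
    _∷_ : ∀ {x y z} → Adj x y → Walk y z → Walk x z

  len : ∀ {x y} → Walk x y → ℕ
  len []      = zero
  len (_ ∷ w) = suc (len w)

  verts : ∀ {x y} → Walk x y → List V
  verts {x} []      = x ∷ []
  verts {x} (_ ∷ w) = x ∷ verts w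

  interior : ∀ {x y} → Walk x y → List V
  interior []                       = []
  interior (_ ∷ [])                 = []
  interior (_∷_ {y = y} _ (e ∷ w))  = y ∷ interior (e ∷ w)

  -- a shortest x–y path: a walk from x to y of minimum length
  -- (a walk of minimum length is automatically a path)
  IsShortest : ∀ {x y} → Walk x y → Set
  IsShortest {x} {y} w = (w' : Walk x y) → len w ≤ len w'

  MutualVisibility : (V → Set) → Set
  MutualVisibility S =
    ∀ x y → S x → S y →
      Σ (Walk x y) λ w → IsShortest w × All (λ v → ¬ S v) (interior w)

-- A vertex of the copy T^(c)_r at depth d < r is encoded by c and its
-- address a : Vec Bool d (the sequence of left/right choices from the
-- root, most recent choice first).  Quasi-leaves (shared by both copies)
-- are the addresses of length r.

data GTVertex (r : ℕ) : Set where
  inner : (c : Bool) (d : ℕ) .(d<r : d < r) (a : Vec Bool d) → GTVertex r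
  quasi : Vec Bool r → GTVertex r

data GTChild (r : ℕ) : GTVertex r → GTVertex r → Set where
  toInner : ∀ c d .(p : d < r) .(q : suc d < r) (a : Vec Bool d) (b : Bool) →
            GTChild r (inner c d p a) (inner c (suc d) q (b ∷ a))
  toQuasi : ∀ c d .(p : d < r) (a : Vec Bool d) (b : Bool) (v : Vec Bool r) →
            toList v ≡ toList (b ∷ a) →
            GTChild r (inner c d p a) (quasi v)

data GTAdj (r : ℕ) (x y : GTVertex r) : Set where
  down : GTChild r x y → GTAdj r x y
  up   : GTChild r y x → GTAdj r x y

module GT (r : ℕ) = Graph (GTAdj r)

-- vertex set of the cycle C_{i,j} = P_{i,j} ∪ P'_{i,j}: the vertices lying
-- on a shortest v_i–v_j path in GT(r)
OnCycle : (r : ℕ) → Vec Bool r → Vec Bool r → GTVertex r → Set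
OnCycle r i j x =
  Σ (GT.Walk r (quasi i) (quasi j)) λ w → GT.IsShortest r w × x ∈ GT.verts r w

-- Give every vertex of GT(r) a level: its depth in T⁽¹⁾, r at the quasi-leaves, and 2r minus its
-- depth in T⁽²⁾. Every edge changes the level by one, so a walk whose length is the difference of
-- the levels of its ends is monotone, and a monotone walk visits every ancestor it passes over.
-- A shortest v_i–v_j path therefore turns at the last common ancestor ("stem") of v_i and v_j in
-- one of the two copies, and C_{i,j} consists of the ancestors of v_i and v_j not above the stem,
-- in both copies.
--
-- Suppose four vertices of a mutual-visibility set S lie on C_{i,j} and let x be a deepest one; by
-- the symmetries of GT(r) it lies in T⁽¹⁾ on the v_i side. List the vertices of C_{i,j} that are no
-- deeper than x along the cycle, starting at x. Comparing lengths with walks through a stem or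
-- through the quasi-leaf v_i shows that every shortest path from x to such a vertex y contains
-- either all of them before y or all of them after y. Taking for y the middle one of the other
-- three vertices, one of the outer two lies inside every shortest x–y path.

module Submission where

open import Defs
open import Data.Bool as Bool using (Bool; true; false; not)
open import Data.Empty using (⊥; ⊥-elim)
open import Data.List as List using (List; []; _∷_; length)
open import Data.List.Membership.Propositional using (_∈_)
open import Data.List.Properties using (≡-dec; ∷-injectiveˡ; ∷-injectiveʳ)
open import Data.List.Relation.Binary.Pointwise using (Pointwise-≡⇒≡; ≡⇒Pointwise-≡; Pointwise-length)
open import Data.List.Relation.Binary.Suffix.Heterogeneous using (Suffix; here; there)
import Data.List.Relation.Binary.Suffix.Heterogeneous.Properties as Suffix
open import Data.List.Relation.Unary.All as All using (All; []; _∷_)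
import Data.List.Relation.Unary.All.Properties as All
open import Data.List.Relation.Unary.AllPairs using ([]; _∷_)
open import Data.List.Relation.Unary.Any using (here; there)
open import Data.List.Relation.Unary.Unique.Propositional using (Unique)
import Data.List.Relation.Unary.Unique.Propositional.Properties as Unique
open import Data.Nat using (ℕ; suc; _+_; _∸_; _≤_; _<_; z≤n; s≤s; _≤?_; _<?_)
open import Data.Nat.Properties
open import Algebra.Properties.CommutativeSemigroup +-commutativeSemigroup
  using (interchange; xy∙z≈xz∙y; xy∙z≈y∙xz)
open import Data.Nat.Tactic.RingSolver using (solve-∀)
open import Data.Product as Product using (Σ-syntax; _×_; _,_; proj₁; proj₂)
open import Data.Product.Relation.Binary.Lex.Strict using (×-Lex; ×-compare; ×-irreflexive)
open import Data.Product.Relation.Binary.Pointwise.NonDependent using (Pointwise; ≡×≡⇒≡)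
open import Data.Sum as Sum using (_⊎_; inj₁; inj₂)
open import Data.Vec using (Vec; []; _∷_; toList; fromList)
open import Data.Vec.Properties using (length-toList; toList-injective; cast-is-id; toList∘fromList)
open import Function using (_∘_)
open import Relation.Binary using (Decidable; Trichotomous; tri<; tri≈; tri>)
open import Relation.Binary.PropositionalEquality as ≡
  using (_≡_; _≢_; refl; sym; trans; cong; cong₂; subst; subst₂; ≢-sym; module ≡-Reasoning)
open import Relation.Nullary using (¬_; yes; no)
open import Relation.Nullary.Decidable using (recompute)

+-tight : ∀ {a a′ b b′} → a ≤ a′ → b ≤ b′ → a′ + b′ ≤ a + b → a ≡ a′ × b ≡ b′
+-tight {a} {a′} {b} {b′} a≤a′ b≤b′ a′+b′≤a+b =
  ≤-antisym a≤a′ (+-cancelʳ-≤ b′ a′ a (≤-trans a′+b′≤a+b (+-monoʳ-≤ a b≤b′))) ,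
  ≤-antisym b≤b′ (+-cancelˡ-≤ a′ b′ b (≤-trans a′+b′≤a+b (+-monoˡ-≤ b a≤a′)))

+-double-cancel-≤ : ∀ {m n} → m + m ≤ n + n → m ≤ n
+-double-cancel-≤ {m} {n} m+m≤n+n with m ≤? n
... | yes m≤n = m≤n
... | no m≰n = ⊥-elim (<⇒≱ (+-mono-< (≰⇒> m≰n) (≰⇒> m≰n)) m+m≤n+n)

+-shift : ∀ m n o → m + n + o ≡ m + (o + n)
+-shift m n o = trans (+-assoc m n o) (cong (m +_) (+-comm n o))

reflect-≤ : ∀ {h c R ℓ} → h + c ≡ R + R → c + c + ℓ ≤ R + R → R + R + ℓ ≤ h + h
reflect-≤ {h} {c} {R} {ℓ} h+c≡2R budget = +-cancelʳ-≤ (c + c) (R + R + ℓ) (h + h) (begin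
  R + R + ℓ + (c + c)   ≡⟨ +-shift (R + R) ℓ (c + c) ⟩
  R + R + (c + c + ℓ)   ≤⟨ +-monoʳ-≤ (R + R) budget ⟩
  R + R + (R + R)       ≡⟨ cong₂ _+_ h+c≡2R h+c≡2R ⟨
  (h + c) + (h + c)     ≡⟨ interchange h c h c ⟩
  h + h + (c + c)       ∎)
  where open ≤-Reasoning

middle-of-three : ∀ {A B : Set} {_≈_ _<_ : B → B → Set} → Trichotomous _≈_ _<_ → (f : A → B) →
                  ∀ {P : A → Set} {a b c} → P a → P b → P c → ¬ f a ≈ f b → ¬ f a ≈ f c → ¬ f b ≈ f c →
                  Σ[ u ∈ A ] Σ[ y ∈ A ] Σ[ v ∈ A ] P u × P y × P v × f u < f y × f y < f v
middle-of-three compare f {a = a} {b} {c} pa pb pc a≉b a≉c b≉c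
  with compare (f a) (f b) | compare (f b) (f c) | compare (f a) (f c)
... | tri≈ _ a≈b _ | _ | _ = ⊥-elim (a≉b a≈b)
... | _ | tri≈ _ b≈c _ | _ = ⊥-elim (b≉c b≈c)
... | _ | _ | tri≈ _ a≈c _ = ⊥-elim (a≉c a≈c)
... | tri< a<b _ _ | tri< b<c _ _ | _ = a , b , c , pa , pb , pc , a<b , b<c
... | tri> _ _ b<a | tri> _ _ c<b | _ = c , b , a , pc , pb , pa , c<b , b<a
... | tri< a<b _ _ | tri> _ _ c<b | tri< a<c _ _ = a , c , b , pa , pc , pb , a<c , c<b
... | tri< a<b _ _ | tri> _ _ c<b | tri> _ _ c<a = c , a , b , pc , pa , pb , c<a , a<b
... | tri> _ _ b<a | tri< b<c _ _ | tri< a<c _ _ = b , a , c , pb , pa , pc , b<a , a<c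
... | tri> _ _ b<a | tri< b<c _ _ | tri> _ _ c<a = b , c , a , pb , pc , pa , b<c , c<a

max-of-four : ∀ a b c d → (b ≤ a × c ≤ a × d ≤ a) ⊎ (a ≤ b × c ≤ b × d ≤ b) ⊎
              (a ≤ c × b ≤ c × d ≤ c) ⊎ (a ≤ d × b ≤ d × c ≤ d)
max-of-four a b c d with ≤-total a b | ≤-total c d
... | inj₂ b≤a | inj₂ d≤c with ≤-total c a
...   | inj₁ c≤a = inj₁ (b≤a , c≤a , ≤-trans d≤c c≤a)
...   | inj₂ a≤c = inj₂ (inj₂ (inj₁ (a≤c , ≤-trans b≤a a≤c , d≤c)))
max-of-four a b c d | inj₂ b≤a | inj₁ c≤d with ≤-total d a
...   | inj₁ d≤a = inj₁ (b≤a , ≤-trans c≤d d≤a , d≤a)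
...   | inj₂ a≤d = inj₂ (inj₂ (inj₂ (a≤d , ≤-trans b≤a a≤d , c≤d)))
max-of-four a b c d | inj₁ a≤b | inj₂ d≤c with ≤-total c b
...   | inj₁ c≤b = inj₂ (inj₁ (a≤b , c≤b , ≤-trans d≤c c≤b))
...   | inj₂ b≤c = inj₂ (inj₂ (inj₁ (≤-trans a≤b b≤c , b≤c , d≤c)))
max-of-four a b c d | inj₁ a≤b | inj₁ c≤d with ≤-total d b
...   | inj₁ d≤b = inj₂ (inj₁ (a≤b , ≤-trans c≤d d≤b , d≤b))
...   | inj₂ b≤d = inj₂ (inj₂ (inj₂ (≤-trans a≤b b≤d , b≤d , c≤d)))

maximum-first : ∀ {A : Set} (f : A → ℕ) {P : A → Set} {a b c d} →
                Unique (a ∷ b ∷ c ∷ d ∷ []) → All P (a ∷ b ∷ c ∷ d ∷ []) →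
                Σ[ x ∈ A ] Σ[ y₁ ∈ A ] Σ[ y₂ ∈ A ] Σ[ y₃ ∈ A ]
                  Unique (x ∷ y₁ ∷ y₂ ∷ y₃ ∷ []) × P x × All (λ y → P y × f y ≤ f x) (y₁ ∷ y₂ ∷ y₃ ∷ [])
maximum-first f {a = a} {b} {c} {d} ((a≢b ∷ a≢c ∷ a≢d ∷ []) ∷ (b≢c ∷ b≢d ∷ []) ∷ (c≢d ∷ []) ∷ [] ∷ [])
              (pa ∷ pb ∷ pc ∷ pd ∷ []) with max-of-four (f a) (f b) (f c) (f d)
... | inj₁ (b≤a , c≤a , d≤a) =
  a , b , c , d , ((a≢b ∷ a≢c ∷ a≢d ∷ []) ∷ (b≢c ∷ b≢d ∷ []) ∷ (c≢d ∷ []) ∷ [] ∷ []) ,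
  pa , (pb , b≤a) ∷ (pc , c≤a) ∷ (pd , d≤a) ∷ []
... | inj₂ (inj₁ (a≤b , c≤b , d≤b)) =
  b , a , c , d , ((≢-sym a≢b ∷ b≢c ∷ b≢d ∷ []) ∷ (a≢c ∷ a≢d ∷ []) ∷ (c≢d ∷ []) ∷ [] ∷ []) ,
  pb , (pa , a≤b) ∷ (pc , c≤b) ∷ (pd , d≤b) ∷ []
... | inj₂ (inj₂ (inj₁ (a≤c , b≤c , d≤c))) =
  c , a , b , d , ((≢-sym a≢c ∷ ≢-sym b≢c ∷ c≢d ∷ []) ∷ (a≢b ∷ a≢d ∷ []) ∷ (b≢d ∷ []) ∷ [] ∷ []) ,
  pc , (pa , a≤c) ∷ (pb , b≤c) ∷ (pd , d≤c) ∷ []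
... | inj₂ (inj₂ (inj₂ (a≤d , b≤d , c≤d))) =
  d , a , b , c , ((≢-sym a≢d ∷ ≢-sym b≢d ∷ ≢-sym c≢d ∷ []) ∷ (a≢b ∷ a≢c ∷ []) ∷ (b≢c ∷ []) ∷ [] ∷ []) ,
  pd , (pa , a≤d) ∷ (pb , b≤d) ∷ (pc , c≤d) ∷ []

at-most-three : ∀ {A : Set} {P : A → Set} →
                (∀ {a b c d} → Unique (a ∷ b ∷ c ∷ d ∷ []) → All P (a ∷ b ∷ c ∷ d ∷ []) → ⊥) →
                ∀ xs → Unique xs → All P xs → length xs ≤ 3
at-most-three _ [] _ _ = z≤n
at-most-three _ (_ ∷ []) _ _ = s≤s z≤n
at-most-three _ (_ ∷ _ ∷ []) _ _ = s≤s (s≤s z≤n)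
at-most-three _ (_ ∷ _ ∷ _ ∷ []) _ _ = s≤s (s≤s (s≤s z≤n))
at-most-three noFour (_ ∷ _ ∷ _ ∷ _ ∷ _) unique all = ⊥-elim (noFour (Unique.take⁺ 4 unique) (All.take⁺ 4 all))

toList-subst : ∀ {A : Set} {m n} (m≡n : m ≡ n) (v : Vec A m) → toList (subst (Vec A) m≡n v) ≡ toList v
toList-subst refl v = refl

Vec-toList-injective : ∀ {A : Set} {n} {v v′ : Vec A n} → toList v ≡ toList v′ → v ≡ v′
Vec-toList-injective {v = v} {v′} eq = trans (sym (cast-is-id refl v)) (toList-injective refl v v′ eq)

infix 4 _⊑_ _⊑?_ _◁_

-- Addresses list the most recent step first, so α ⊑ β says that α addresses an ancestor of β.
_⊑_ : List Bool → List Bool → Set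
_⊑_ = Suffix _≡_

_⊑?_ : Decidable _⊑_
_⊑?_ = Suffix.suffix? Bool._≟_

_◁_ : List Bool → List Bool → Set
α ◁ β = Σ[ b ∈ Bool ] β ≡ b ∷ α

⊑-refl : ∀ {α} → α ⊑ α
⊑-refl = here (≡⇒Pointwise-≡ refl)

⊑-trans : ∀ {α β γ} → α ⊑ β → β ⊑ γ → α ⊑ γ
⊑-trans = Suffix.trans ≡.trans

⊑-length : ∀ {α β} → α ⊑ β → length α ≤ length β
⊑-length = Suffix.length-mono

⊑-comparable : ∀ {α β γ} → α ⊑ γ → β ⊑ γ → length α ≤ length β → α ⊑ β
⊑-comparable {α} α⊑γ (here β≈γ) _ = subst (α ⊑_) (sym (Pointwise-≡⇒≡ β≈γ)) α⊑γ
⊑-comparable {β = β} (here α≈γ) (there β⊑γ) ∣α∣≤∣β∣ =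
  ⊥-elim (<⇒≱ (s≤s (⊑-length β⊑γ)) (subst (_≤ length β) (Pointwise-length α≈γ) ∣α∣≤∣β∣))
⊑-comparable (there α⊑γ) (there β⊑γ) ∣α∣≤∣β∣ = ⊑-comparable α⊑γ β⊑γ ∣α∣≤∣β∣

⊑-unique : ∀ {α β γ} → α ⊑ γ → β ⊑ γ → length α ≡ length β → α ≡ β
⊑-unique α⊑γ β⊑γ eq =
  Pointwise-≡⇒≡ (Suffix.toPointwise eq (⊑-comparable α⊑γ β⊑γ (≤-reflexive eq)))

⊑-◁ : ∀ {α β} → α ◁ β → α ⊑ β
⊑-◁ (b , refl) = there ⊑-refl

⊑-∷⁻ : ∀ {α β b} → α ⊑ b ∷ β → α ≡ b ∷ β ⊎ α ⊑ β
⊑-∷⁻ (here α≈bβ) = inj₁ (Pointwise-≡⇒≡ α≈bβ)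
⊑-∷⁻ (there α⊑β) = inj₂ α⊑β

-- The stem of two addresses is the address of their last common ancestor.
record Fork (α β : List Bool) : Set where
  field
    stem            : List Bool
    bitˡ bitʳ       : Bool
    bitˡ≢bitʳ       : bitˡ ≢ bitʳ
    bitˡ∷stem⊑α     : bitˡ ∷ stem ⊑ α
    bitʳ∷stem⊑β     : bitʳ ∷ stem ⊑ β

fork : ∀ α β → length α ≡ length β → α ≢ β → Fork α β
fork [] [] _ α≢β = ⊥-elim (α≢β refl)
fork (a ∷ α) (b ∷ β) ∣α∣≡∣β∣ aα≢bβ with ≡-dec Bool._≟_ α β
... | yes refl = record { stem = α ; bitˡ = a ; bitʳ = b ; bitˡ≢bitʳ = aα≢bβ ∘ cong (_∷ α)
                        ; bitˡ∷stem⊑α = ⊑-refl ; bitʳ∷stem⊑β = ⊑-refl }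
... | no α≢β = record { stem = stem ; bitˡ = bitˡ ; bitʳ = bitʳ ; bitˡ≢bitʳ = bitˡ≢bitʳ
                       ; bitˡ∷stem⊑α = there bitˡ∷stem⊑α ; bitʳ∷stem⊑β = there bitʳ∷stem⊑β }
  where open Fork (fork α β (suc-injective ∣α∣≡∣β∣) α≢β)

Fork-swap : ∀ {α β} → Fork α β → Fork β α
Fork-swap φ = record { stem = stem ; bitˡ = bitʳ ; bitʳ = bitˡ ; bitˡ≢bitʳ = ≢-sym bitˡ≢bitʳ
                     ; bitˡ∷stem⊑α = bitʳ∷stem⊑β ; bitʳ∷stem⊑β = bitˡ∷stem⊑α }
  where open Fork φ

module Walks {V : Set} {Adj : V → V → Set} (Adj-sym : ∀ {x y} → Adj x y → Adj y x) where

  open Graph Adj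

  infixr 5 _++ʷ_

  _++ʷ_ : ∀ {x y z} → Walk x y → Walk y z → Walk x z
  [] ++ʷ w′ = w′
  (e ∷ w) ++ʷ w′ = e ∷ (w ++ʷ w′)

  len-++ʷ : ∀ {x y z} (w : Walk x y) (w′ : Walk y z) → len (w ++ʷ w′) ≡ len w + len w′
  len-++ʷ [] w′ = refl
  len-++ʷ (e ∷ w) w′ = cong suc (len-++ʷ w w′)

  reverse : ∀ {x y} → Walk x y → Walk y x
  reverse [] = []
  reverse (e ∷ w) = reverse w ++ʷ (Adj-sym e ∷ [])

  len-reverse : ∀ {x y} (w : Walk x y) → len (reverse w) ≡ len w
  len-reverse [] = refl
  len-reverse (e ∷ w) = trans (len-++ʷ (reverse w) _) (trans (+-comm (len (reverse w)) 1) (cong suc (len-reverse w)))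

  start∈verts : ∀ {x y} (w : Walk x y) → x ∈ verts w
  start∈verts [] = here refl
  start∈verts (e ∷ w) = here refl

  end∈verts : ∀ {x y} (w : Walk x y) → y ∈ verts w
  end∈verts [] = here refl
  end∈verts (e ∷ w) = there (end∈verts w)

  ∈-verts-++⁺ˡ : ∀ {x y z u} (w : Walk x y) (w′ : Walk y z) → u ∈ verts w → u ∈ verts (w ++ʷ w′)
  ∈-verts-++⁺ˡ [] w′ (here refl) = start∈verts w′
  ∈-verts-++⁺ˡ (e ∷ w) w′ (here refl) = here refl
  ∈-verts-++⁺ˡ (e ∷ w) w′ (there u∈w) = there (∈-verts-++⁺ˡ w w′ u∈w)

  ∈-verts-++⁺ʳ : ∀ {x y z u} (w : Walk x y) (w′ : Walk y z) → u ∈ verts w′ → u ∈ verts (w ++ʷ w′)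
  ∈-verts-++⁺ʳ [] w′ u∈w′ = u∈w′
  ∈-verts-++⁺ʳ (e ∷ w) w′ u∈w′ = there (∈-verts-++⁺ʳ w w′ u∈w′)

  ∈-verts-++⁻ : ∀ {x y z u} (w : Walk x y) (w′ : Walk y z) → u ∈ verts (w ++ʷ w′) → u ∈ verts w ⊎ u ∈ verts w′
  ∈-verts-++⁻ [] w′ u∈ = inj₂ u∈
  ∈-verts-++⁻ (e ∷ w) w′ (here refl) = inj₁ (here refl)
  ∈-verts-++⁻ (e ∷ w) w′ (there u∈) with ∈-verts-++⁻ w w′ u∈
  ... | inj₁ u∈w = inj₁ (there u∈w)
  ... | inj₂ u∈w′ = inj₂ u∈w′

  ∈-verts-reverse⁺ : ∀ {x y u} (w : Walk x y) → u ∈ verts w → u ∈ verts (reverse w)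
  ∈-verts-reverse⁺ [] u∈w = u∈w
  ∈-verts-reverse⁺ (e ∷ w) (here refl) = ∈-verts-++⁺ʳ (reverse w) _ (there (here refl))
  ∈-verts-reverse⁺ (e ∷ w) (there u∈w) = ∈-verts-++⁺ˡ (reverse w) _ (∈-verts-reverse⁺ w u∈w)

  ∈-verts-reverse⁻ : ∀ {x y u} (w : Walk x y) → u ∈ verts (reverse w) → u ∈ verts w
  ∈-verts-reverse⁻ [] u∈ = u∈
  ∈-verts-reverse⁻ (e ∷ w) u∈ with ∈-verts-++⁻ (reverse w) (Adj-sym e ∷ []) u∈
  ... | inj₁ u∈w = there (∈-verts-reverse⁻ w u∈w)
  ... | inj₂ (here refl) = there (start∈verts w)
  ... | inj₂ (there (here refl)) = here refl

  split-at : ∀ {x y v} (w : Walk x y) → v ∈ verts w → Σ[ w₁ ∈ Walk x v ] Σ[ w₂ ∈ Walk v y ] w ≡ w₁ ++ʷ w₂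
  split-at [] (here refl) = [] , [] , refl
  split-at (e ∷ w) (here refl) = [] , e ∷ w , refl
  split-at (e ∷ w) (there v∈w) with split-at w v∈w
  ... | w₁ , w₂ , refl = e ∷ w₁ , w₂ , refl

  ∈-verts⇒start⊎interior : ∀ {x y u} (w : Walk x y) → u ∈ verts w → u ≢ y → u ≡ x ⊎ u ∈ interior w
  ∈-verts⇒start⊎interior [] (here refl) _ = inj₁ refl
  ∈-verts⇒start⊎interior (e ∷ []) (here refl) _ = inj₁ refl
  ∈-verts⇒start⊎interior (e ∷ []) (there (here refl)) u≢y = ⊥-elim (u≢y refl)
  ∈-verts⇒start⊎interior (e ∷ e′ ∷ w) (here refl) _ = inj₁ refl
  ∈-verts⇒start⊎interior (e ∷ e′ ∷ w) (there u∈) u≢y with ∈-verts⇒start⊎interior (e′ ∷ w) u∈ u≢y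
  ... | inj₁ refl = inj₂ (here refl)
  ... | inj₂ u∈interior = inj₂ (there u∈interior)

  ∈-interior : ∀ {x y u} (w : Walk x y) → u ∈ verts w → u ≢ x → u ≢ y → u ∈ interior w
  ∈-interior w u∈w u≢x u≢y with ∈-verts⇒start⊎interior w u∈w u≢y
  ... | inj₁ u≡x = ⊥-elim (u≢x u≡x)
  ... | inj₂ u∈interior = u∈interior

  castʷ : ∀ {x x′ y y′} → x ≡ x′ → y ≡ y′ → Walk x y → Walk x′ y′
  castʷ refl refl w = w

  len-castʷ : ∀ {x x′ y y′} (p : x ≡ x′) (q : y ≡ y′) (w : Walk x y) → len (castʷ p q w) ≡ len w
  len-castʷ refl refl w = refl

  interior-castʷ : ∀ {x x′ y y′} (p : x ≡ x′) (q : y ≡ y′) (w : Walk x y) → interior (castʷ p q w) ≡ interior w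
  interior-castʷ refl refl w = refl

  module _ (f : V → V) (f-adj : ∀ {x y} → Adj x y → Adj (f x) (f y)) where

    mapʷ : ∀ {x y} → Walk x y → Walk (f x) (f y)
    mapʷ [] = []
    mapʷ (e ∷ w) = f-adj e ∷ mapʷ w

    len-mapʷ : ∀ {x y} (w : Walk x y) → len (mapʷ w) ≡ len w
    len-mapʷ [] = refl
    len-mapʷ (e ∷ w) = cong suc (len-mapʷ w)

    interior-mapʷ : ∀ {x y} (w : Walk x y) → interior (mapʷ w) ≡ List.map f (interior w)
    interior-mapʷ [] = refl
    interior-mapʷ (e ∷ []) = refl
    interior-mapʷ (e ∷ e′ ∷ w) = cong (f _ ∷_) (interior-mapʷ (e′ ∷ w))

    MutualVisibility-∘ : (∀ x → f (f x) ≡ x) → ∀ {S : V → Set} → MutualVisibility S → MutualVisibility (S ∘ f)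
    MutualVisibility-∘ f-involutive {S} mv x y Sfx Sfy with mv (f x) (f y) Sfx Sfy
    ... | w , shortest , free = w′ , shortest′ , free′
      where
      w′ : Walk x y
      w′ = castʷ (f-involutive x) (f-involutive y) (mapʷ w)

      len-w′ : len w′ ≡ len w
      len-w′ = trans (len-castʷ (f-involutive x) (f-involutive y) (mapʷ w)) (len-mapʷ w)

      shortest′ : IsShortest w′
      shortest′ w″ = begin
        len w′          ≡⟨ len-w′ ⟩
        len w           ≤⟨ shortest (mapʷ w″) ⟩
        len (mapʷ w″)   ≡⟨ len-mapʷ w″ ⟩
        len w″          ∎
        where open ≤-Reasoning

      free′ : All (¬_ ∘ S ∘ f) (interior w′)
      free′ = subst (All (¬_ ∘ S ∘ f))
                    (sym (trans (interior-castʷ (f-involutive x) (f-involutive y) (mapʷ w)) (interior-mapʷ w)))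
                    (All.map⁺ (All.map (λ {v} ¬Sv Sffv → ¬Sv (subst S (f-involutive v) Sffv)) free))

module Layered {V : Set} {Adj : V → V → Set} (Adj-sym : ∀ {x y} → Adj x y → Adj y x)
               (level : V → ℕ) (level-adj : ∀ {x y} → Adj x y → level y ≡ suc (level x) ⊎ level x ≡ suc (level y))
               where

  open Graph Adj
  open Walks {Adj = Adj} Adj-sym

  Ascending : ∀ {x y} → Walk x y → Set
  Ascending {x} {y} w = level x + len w ≡ level y

  Descending : ∀ {x y} → Walk x y → Set
  Descending {x} {y} w = level y + len w ≡ level x

  level-≤ : ∀ {x y} (w : Walk x y) → level y ≤ level x + len w
  level-≤ {x} [] = m≤m+n (level x) 0
  level-≤ {x} {y} (_∷_ {y = x₁} e w) with level-adj e
  ... | inj₁ rise = begin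
    level y               ≤⟨ level-≤ w ⟩
    level x₁ + len w      ≡⟨ cong (_+ len w) rise ⟩
    suc (level x) + len w ≡⟨ +-suc (level x) (len w) ⟨
    level x + len (e ∷ w) ∎
    where open ≤-Reasoning
  ... | inj₂ fall = begin
    level y               ≤⟨ level-≤ w ⟩
    level x₁ + len w      ≤⟨ +-monoˡ-≤ (len w) (n≤1+n (level x₁)) ⟩
    suc (level x₁) + len w ≡⟨ cong (_+ len w) fall ⟨
    level x + len w       ≤⟨ +-monoʳ-≤ (level x) (n≤1+n (len w)) ⟩
    level x + len (e ∷ w) ∎
    where open ≤-Reasoning

  level-≥ : ∀ {x y} (w : Walk x y) → level x ≤ level y + len w
  level-≥ {x} {y} [] = m≤m+n (level x) 0
  level-≥ {x} {y} (_∷_ {y = x₁} e w) with level-adj e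
  ... | inj₁ rise = begin
    level x               ≤⟨ n≤1+n (level x) ⟩
    suc (level x)         ≡⟨ rise ⟨
    level x₁              ≤⟨ level-≥ w ⟩
    level y + len w       ≤⟨ +-monoʳ-≤ (level y) (n≤1+n (len w)) ⟩
    level y + len (e ∷ w) ∎
    where open ≤-Reasoning
  ... | inj₂ fall = begin
    level x               ≡⟨ fall ⟩
    suc (level x₁)        ≤⟨ s≤s (level-≥ w) ⟩
    suc (level y + len w) ≡⟨ +-suc (level y) (len w) ⟨
    level y + len (e ∷ w) ∎
    where open ≤-Reasoning

  ascending : ∀ {x y} (w : Walk x y) → level x + len w ≤ level y → Ascending w
  ascending w bound = ≤-antisym bound (level-≤ w)

  descending : ∀ {x y} (w : Walk x y) → level y + len w ≤ level x → Descending w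
  descending w bound = ≤-antisym bound (level-≥ w)

  +-len-++ʷ : ∀ a b {x v y} (w₁ : Walk x v) (w₂ : Walk v y) → (a + len w₁) + (b + len w₂) ≡ a + b + len (w₁ ++ʷ w₂)
  +-len-++ʷ a b w₁ w₂ = trans (interchange a (len w₁) b (len w₂)) (cong (a + b +_) (sym (len-++ʷ w₁ w₂)))

  valley : ∀ {x v y} (w₁ : Walk x v) (w₂ : Walk v y) →
           level v + level v + len (w₁ ++ʷ w₂) ≤ level x + level y → Descending w₁ × Ascending w₂
  valley {v = v} w₁ w₂ bound = sym (proj₁ tight) , sym (proj₂ tight)
    where
    tight = +-tight (level-≥ w₁) (level-≤ w₂) (≤-trans (≤-reflexive (+-len-++ʷ (level v) (level v) w₁ w₂)) bound)

  peak : ∀ {x v y} (w₁ : Walk x v) (w₂ : Walk v y) →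
         level x + level y + len (w₁ ++ʷ w₂) ≤ level v + level v → Ascending w₁ × Descending w₂
  peak {x} {y = y} w₁ w₂ bound = sym (proj₁ tight) , sym (proj₂ tight)
    where
    tight = +-tight (level-≤ w₁) (level-≥ w₂) (≤-trans (≤-reflexive (+-len-++ʷ (level x) (level y) w₁ w₂)) bound)

  valley-bound : ∀ {x v y} (w₁ : Walk x v) (w₂ : Walk v y) → level x + level y ≤ level v + level v + len (w₁ ++ʷ w₂)
  valley-bound {v = v} w₁ w₂ =
    ≤-trans (+-mono-≤ (level-≥ w₁) (level-≤ w₂)) (≤-reflexive (+-len-++ʷ (level v) (level v) w₁ w₂))

  peak-bound : ∀ {x v y} (w₁ : Walk x v) (w₂ : Walk v y) → level v + level v ≤ level x + level y + len (w₁ ++ʷ w₂)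
  peak-bound {x} {y = y} w₁ w₂ =
    ≤-trans (+-mono-≤ (level-≤ w₁) (level-≥ w₂)) (≤-reflexive (+-len-++ʷ (level x) (level y) w₁ w₂))

  descending-reverse : ∀ {x y} (w : Walk x y) → Descending w → Ascending (reverse w)
  descending-reverse {y = y} w desc = trans (cong (level y +_) (len-reverse w)) desc

  ascending-∷ : ∀ {x x₁ y} (e : Adj x x₁) (w : Walk x₁ y) → Ascending (e ∷ w) → level x₁ ≡ suc (level x) × Ascending w
  ascending-∷ {x} {x₁} {y} e w asc with level-adj e
  ... | inj₁ rise = rise , (begin
    level x₁ + len w      ≡⟨ cong (_+ len w) rise ⟩
    suc (level x) + len w ≡⟨ +-suc (level x) (len w) ⟨
    level x + len (e ∷ w) ≡⟨ asc ⟩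
    level y               ∎)
    where open ≡-Reasoning
  ... | inj₂ fall = ⊥-elim (<-irrefl refl (begin-strict
    level y                ≤⟨ level-≤ w ⟩
    level x₁ + len w       <⟨ +-monoˡ-< (len w) (n<1+n (level x₁)) ⟩
    suc (level x₁) + len w ≡⟨ cong (_+ len w) fall ⟨
    level x + len w        ≤⟨ +-monoʳ-≤ (level x) (n≤1+n (len w)) ⟩
    level x + len (e ∷ w)  ≡⟨ asc ⟩
    level y                ∎))
    where open ≤-Reasoning

  ascending-levels : ∀ {x y h} (w : Walk x y) → Ascending w → level x ≤ h → h ≤ level y →
                     Σ[ u ∈ V ] u ∈ verts w × level u ≡ h
  ascending-levels {x} [] _ x≤h h≤x = x , here refl , ≤-antisym x≤h h≤x
  ascending-levels {x} {h = h} (e ∷ w) asc x≤h h≤y with m≤n⇒m<n∨m≡n x≤h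
  ... | inj₂ x≡h = x , here refl , x≡h
  ... | inj₁ x<h with ascending-∷ e w asc
  ...   | rise , asc′ with ascending-levels w asc′ (subst (_≤ h) (sym rise) x<h) h≤y
  ...     | u , u∈w , u≡h = u , there u∈w , u≡h

  ascending-++⁻ : ∀ {x v y} (w₁ : Walk x v) (w₂ : Walk v y) → Ascending (w₁ ++ʷ w₂) → Ascending w₁ × Ascending w₂
  ascending-++⁻ {x} {v} {y} w₁ w₂ asc = sym (proj₁ tight) , sym (proj₂ tight)
    where
    bound : (level x + len w₁) + (level v + len w₂) ≤ level v + level y
    bound = ≤-reflexive (begin
      (level x + len w₁) + (level v + len w₂) ≡⟨ +-len-++ʷ (level x) (level v) w₁ w₂ ⟩
      level x + level v + len (w₁ ++ʷ w₂)     ≡⟨ xy∙z≈y∙xz (level x) (level v) _ ⟩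
      level v + (level x + len (w₁ ++ʷ w₂))   ≡⟨ cong (level v +_) asc ⟩
      level v + level y                       ∎)
      where open ≡-Reasoning
    tight = +-tight (level-≤ w₁) (level-≤ w₂) bound

  ascending-range : ∀ {x y u} (w : Walk x y) → Ascending w → u ∈ verts w → level x ≤ level u × level u ≤ level y
  ascending-range w asc u∈w with split-at w u∈w
  ... | w₁ , w₂ , refl with ascending-++⁻ w₁ w₂ asc
  ...   | asc₁ , asc₂ = ≤-trans (m≤m+n _ (len w₁)) (≤-reflexive asc₁) , ≤-trans (m≤m+n _ (len w₂)) (≤-reflexive asc₂)

  descending-range : ∀ {x y u} (w : Walk x y) → Descending w → u ∈ verts w → level y ≤ level u × level u ≤ level x
  descending-range w desc u∈w = ascending-range (reverse w) (descending-reverse w desc) (∈-verts-reverse⁺ w u∈w)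

module Glued (r : ℕ) where

  open GT r

  level : GTVertex r → ℕ
  level (inner false d _ _) = d
  level (inner true d _ _) = r + (r ∸ d)
  level (quasi _) = r

  addr : GTVertex r → List Bool
  addr (inner _ _ _ a) = toList a
  addr (quasi a) = toList a

  depth : GTVertex r → ℕ
  depth u = length (addr u)

  private
    relevant : ∀ {d} → .(d < r) → d < r
    relevant {d} = recompute (d <? r)

    r<upper : ∀ {d} → d < r → r < r + (r ∸ d)
    r<upper d<r = m<m+n r (m<n⇒0<n∸m d<r)

  depth-≤ : ∀ u → depth u ≤ r
  depth-≤ (inner _ d d<r a) = ≤-trans (≤-reflexive (length-toList a)) (<⇒≤ (relevant d<r))
  depth-≤ (quasi a) = ≤-reflexive (length-toList a)

  depth-quasi : ∀ a → depth (quasi a) ≡ r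
  depth-quasi = length-toList

  lower-level : ∀ u → level u ≤ r → level u ≡ depth u
  lower-level (inner false d _ a) _ = sym (length-toList a)
  lower-level (inner true d d<r a) ≤r = ⊥-elim (<⇒≱ (r<upper (relevant d<r)) ≤r)
  lower-level (quasi a) _ = sym (length-toList a)

  upper-level : ∀ u → r ≤ level u → level u + depth u ≡ r + r
  upper-level (inner false d d<r a) r≤d = ⊥-elim (<⇒≱ (relevant d<r) r≤d)
  upper-level (inner true d d<r a) _ = begin
    r + (r ∸ d) + length (toList a) ≡⟨ cong (r + (r ∸ d) +_) (length-toList a) ⟩
    r + (r ∸ d) + d                 ≡⟨ +-assoc r (r ∸ d) d ⟩
    r + (r ∸ d + d)                 ≡⟨ cong (r +_) (m∸n+n≡m (<⇒≤ (relevant d<r))) ⟩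
    r + r                           ∎
    where open ≡-Reasoning
  upper-level (quasi a) _ = cong (r +_) (length-toList a)

  OnSide : Bool → GTVertex r → Set
  OnSide false u = level u ≤ r
  OnSide true u = r ≤ level u

  OnSide-level : ∀ c {u v} → OnSide c u → OnSide c v → depth u ≡ depth v → level u ≡ level v
  OnSide-level false {u} {v} u≤r v≤r eq = trans (lower-level u u≤r) (trans eq (sym (lower-level v v≤r)))
  OnSide-level true {u} {v} r≤u r≤v eq =
    +-cancelʳ-≡ (depth u) (level u) (level v)
      (trans (upper-level u r≤u) (trans (sym (upper-level v r≤v)) (cong (level v +_) (sym eq))))

  level-≡⇒depth-≡ : ∀ u v → level u ≡ level v → depth u ≡ depth v
  level-≡⇒depth-≡ u v eq with ≤-total (level u) r
  ... | inj₁ u≤r = trans (sym (lower-level u u≤r)) (trans eq (lower-level v (subst (_≤ r) eq u≤r)))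
  ... | inj₂ r≤u = +-cancelˡ-≡ (level u) (depth u) (depth v)
                     (trans (upper-level u r≤u)
                       (trans (sym (upper-level v (subst (r ≤_) eq r≤u))) (cong (_+ depth v) (sym eq))))

  private
    inner-≡ : ∀ {c d d′} .{p : d < r} .{p′ : d′ < r} {a : Vec Bool d} {a′ : Vec Bool d′} →
              toList a ≡ toList a′ → inner c d p a ≡ inner c d′ p′ a′
    inner-≡ {a = a} {a′} eq with trans (sym (length-toList a)) (trans (cong length eq) (length-toList a′))
    ... | refl = cong (inner _ _ _) (Vec-toList-injective eq)

  vertex-≡ : ∀ u v → level u ≡ level v → addr u ≡ addr v → u ≡ v
  vertex-≡ (inner false _ _ _) (inner false _ _ _) _ eq = inner-≡ eq
  vertex-≡ (inner true _ _ _) (inner true _ _ _) _ eq = inner-≡ eq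
  vertex-≡ (quasi _) (quasi _) _ eq = cong quasi (Vec-toList-injective eq)
  vertex-≡ (inner false d d<r _) (inner true d′ d′<r _) eq _ =
    ⊥-elim (<⇒≢ (<-trans (relevant d<r) (r<upper (relevant d′<r))) eq)
  vertex-≡ (inner true d d<r _) (inner false d′ d′<r _) eq _ =
    ⊥-elim (<⇒≢ (<-trans (relevant d′<r) (r<upper (relevant d<r))) (sym eq))
  vertex-≡ (inner false d d<r _) (quasi _) eq _ = ⊥-elim (<⇒≢ (relevant d<r) eq)
  vertex-≡ (quasi _) (inner false d d<r _) eq _ = ⊥-elim (<⇒≢ (relevant d<r) (sym eq))
  vertex-≡ (inner true d d<r _) (quasi _) eq _ = ⊥-elim (<⇒≢ (r<upper (relevant d<r)) (sym eq))
  vertex-≡ (quasi _) (inner true d d<r _) eq _ = ⊥-elim (<⇒≢ (r<upper (relevant d<r)) eq)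

  same-place : ∀ c {z z′ α} → OnSide c z → OnSide c z′ → addr z ⊑ α → addr z′ ⊑ α → depth z ≡ depth z′ → z ≡ z′
  same-place c z-side z′-side z⊑α z′⊑α eq = vertex-≡ _ _ (OnSide-level c z-side z′-side eq) (⊑-unique z⊑α z′⊑α eq)

  lower-level-mono : ∀ u v → level u ≤ r → level v ≤ r → depth u ≤ depth v → level u ≤ level v
  lower-level-mono u v u≤r v≤r u≤v = subst₂ _≤_ (sym (lower-level u u≤r)) (sym (lower-level v v≤r)) u≤v

  upper-level-anti : ∀ u v → r ≤ level u → r ≤ level v → depth u ≤ depth v → level v ≤ level u
  upper-level-anti u v r≤u r≤v u≤v = +-cancelʳ-≤ (depth u) (level v) (level u) (begin
    level v + depth u ≤⟨ +-monoʳ-≤ (level v) u≤v ⟩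
    level v + depth v ≡⟨ upper-level v r≤v ⟩
    r + r             ≡⟨ upper-level u r≤u ⟨
    level u + depth u ∎)
    where open ≤-Reasoning

  UpStep : GTVertex r → GTVertex r → Set
  UpStep u v = level v ≡ suc (level u) × (level u < r × addr u ◁ addr v ⊎ r ≤ level u × addr v ◁ addr u)

  child-step : ∀ {u v} → GTChild r u v → UpStep u v ⊎ UpStep v u
  child-step (toInner false d d<r _ a b) = inj₁ (refl , inj₁ (relevant d<r , b , refl))
  child-step (toInner true d _ 1+d<r a b) = inj₂ (level-parent , inj₂ (m≤m+n r _ , b , refl))
    where
    level-parent : r + (r ∸ d) ≡ suc (r + (r ∸ suc d))
    level-parent = trans (cong (r +_) (+-∸-assoc 1 (<⇒≤ (relevant 1+d<r)))) (+-suc r (r ∸ suc d))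
  child-step (toQuasi false d d<r a b v v≡ba) = inj₁ (r≡1+d , inj₁ (relevant d<r , b , v≡ba))
    where
    r≡1+d : r ≡ suc d
    r≡1+d = trans (sym (length-toList v)) (trans (cong length v≡ba) (cong suc (length-toList a)))
  child-step (toQuasi true d d<r a b v v≡ba) = inj₂ (level-parent , inj₂ (≤-refl , b , v≡ba))
    where
    r≡1+d : r ≡ suc d
    r≡1+d = trans (sym (length-toList v)) (trans (cong length v≡ba) (cong suc (length-toList a)))
    level-parent : r + (r ∸ d) ≡ suc r
    level-parent = trans (cong (λ n → r + (n ∸ d)) r≡1+d) (trans (cong (r +_) (m+n∸n≡m 1 d)) (+-comm r 1))

  GTAdj-sym : ∀ {u v} → GTAdj r u v → GTAdj r v u
  GTAdj-sym (down c) = up c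
  GTAdj-sym (up c) = down c

  adj-step : ∀ {u v} → GTAdj r u v → UpStep u v ⊎ UpStep v u
  adj-step (down c) = child-step c
  adj-step (up c) = Sum.swap (child-step c)

  adj-level : ∀ {u v} → GTAdj r u v → level v ≡ suc (level u) ⊎ level u ≡ suc (level v)
  adj-level e = Sum.map proj₁ proj₁ (adj-step e)

  adj-addr : ∀ {u v} → GTAdj r u v → addr u ◁ addr v ⊎ addr v ◁ addr u
  adj-addr e with adj-step e
  ... | inj₁ (_ , step) = Sum.map proj₂ proj₂ step
  ... | inj₂ (_ , step) = Sum.swap (Sum.map proj₂ proj₂ step)

  open Walks {Adj = GTAdj r} GTAdj-sym public
  open Layered {Adj = GTAdj r} GTAdj-sym level adj-level public

  ascending-step : ∀ {x x₁ y} (e : GTAdj r x x₁) (w : Walk x₁ y) → Ascending (e ∷ w) → UpStep x x₁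
  ascending-step e w asc with adj-step e
  ... | inj₁ step = step
  ... | inj₂ (fall , _) = ⊥-elim (<-irrefl (trans rise (cong suc fall)) (m<n⇒m<1+n (n<1+n _)))
    where rise = proj₁ (ascending-∷ e w asc)

  ascending-crest : ∀ {x y} (w : Walk x y) → Ascending w →
                    Σ[ M ∈ List Bool ] (∀ {u} → u ∈ verts w → addr u ⊑ M) × (r ≤ level x → M ≡ addr x)
  ascending-crest {x} [] _ = addr x , (λ { (here refl) → ⊑-refl }) , λ _ → refl
  ascending-crest {x} (_∷_ {y = x₁} e w) asc
    with ascending-step e w asc | ascending-crest w (proj₂ (ascending-∷ e w asc))
  ... | _ , inj₁ (x<r , x◁x₁) | M , below , _ = M , below′ , λ r≤x → ⊥-elim (<⇒≱ x<r r≤x)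
    where
    below′ : ∀ {u} → u ∈ verts (e ∷ w) → addr u ⊑ M
    below′ (here refl) = ⊑-trans (⊑-◁ x◁x₁) (below (start∈verts w))
    below′ (there u∈w) = below u∈w
  ... | rise , inj₂ (r≤x , x₁◁x) | M , below , M≡x₁ = addr x , below′ , λ _ → refl
    where
    r≤x₁ : r ≤ level x₁
    r≤x₁ = ≤-trans r≤x (≤-trans (n≤1+n _) (≤-reflexive (sym rise)))
    below′ : ∀ {u} → u ∈ verts (e ∷ w) → addr u ⊑ addr x
    below′ (here refl) = ⊑-refl
    below′ (there u∈w) = ⊑-trans (below u∈w) (subst (_⊑ addr x) (sym (M≡x₁ r≤x₁)) (⊑-◁ x₁◁x))

  ascending-comparable : ∀ {x y u u′} (w : Walk x y) → Ascending w → u ∈ verts w → u′ ∈ verts w →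
                         depth u ≤ depth u′ → addr u ⊑ addr u′
  ascending-comparable w asc u∈w u′∈w = ⊑-comparable (below u∈w) (below u′∈w)
    where below = proj₁ (proj₂ (ascending-crest w asc))

  ascending-visits : ∀ {x y z u₀} (w : Walk x y) → Ascending w → level x ≤ level z → level z ≤ level y →
                     u₀ ∈ verts w → addr z ⊑ addr u₀ → z ∈ verts w
  ascending-visits {z = z} w asc x≤z z≤y u₀∈w z⊑u₀ with ascending-levels w asc x≤z z≤y
  ... | u , u∈w , u≡z = subst (_∈ verts w) (vertex-≡ u z u≡z u-addr) u∈w
    where
    below = proj₁ (proj₂ (ascending-crest w asc))
    u-addr : addr u ≡ addr z
    u-addr = ⊑-unique (below u∈w) (⊑-trans z⊑u₀ (below u₀∈w)) (level-≡⇒depth-≡ u z u≡z)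

  descending-comparable : ∀ {x y u u′} (w : Walk x y) → Descending w → u ∈ verts w → u′ ∈ verts w →
                          depth u ≤ depth u′ → addr u ⊑ addr u′
  descending-comparable w desc u∈w u′∈w =
    ascending-comparable (reverse w) (descending-reverse w desc) (∈-verts-reverse⁺ w u∈w) (∈-verts-reverse⁺ w u′∈w)

  descending-visits : ∀ {x y z u₀} (w : Walk x y) → Descending w → level y ≤ level z → level z ≤ level x →
                      u₀ ∈ verts w → addr z ⊑ addr u₀ → z ∈ verts w
  descending-visits w desc y≤z z≤x u₀∈w z⊑u₀ =
    ∈-verts-reverse⁻ w (ascending-visits (reverse w) (descending-reverse w desc) y≤z z≤x
                                         (∈-verts-reverse⁺ w u₀∈w) z⊑u₀)

  vertexAt : Bool → (α : List Bool) → .(length α ≤ r) → GTVertex r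
  vertexAt c α ∣α∣≤r with length α <? r
  ... | yes ∣α∣<r = inner c (length α) ∣α∣<r (fromList α)
  ... | no ∣α∣≮r = quasi (subst (Vec Bool) (≤-antisym (recompute (length α ≤? r) ∣α∣≤r) (≮⇒≥ ∣α∣≮r)) (fromList α))

  addr-vertexAt : ∀ c α .(∣α∣≤r : length α ≤ r) → addr (vertexAt c α ∣α∣≤r) ≡ α
  addr-vertexAt c α _ with length α <? r
  ... | yes _ = toList∘fromList α
  ... | no _ = trans (toList-subst _ (fromList α)) (toList∘fromList α)

  OnSide-vertexAt : ∀ c α .(∣α∣≤r : length α ≤ r) → OnSide c (vertexAt c α ∣α∣≤r)
  OnSide-vertexAt false α ∣α∣≤r with length α <? r
  ... | yes ∣α∣<r = <⇒≤ ∣α∣<r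
  ... | no _ = ≤-refl
  OnSide-vertexAt true α _ with length α <? r
  ... | yes _ = m≤m+n r _
  ... | no _ = ≤-refl

  vertexAt-addr : ∀ c u → OnSide c u → vertexAt c (addr u) (depth-≤ u) ≡ u
  vertexAt-addr c u u-side =
    vertex-≡ _ u (OnSide-level c (OnSide-vertexAt c (addr u) (depth-≤ u)) u-side (cong length addr≡)) addr≡
    where addr≡ = addr-vertexAt c (addr u) (depth-≤ u)

  vertexAt-adj : ∀ c b α .(∣bα∣≤r : suc (length α) ≤ r) →
                 GTAdj r (vertexAt c (b ∷ α) ∣bα∣≤r) (vertexAt c α (≤-trans (n≤1+n _) ∣bα∣≤r))
  vertexAt-adj c b α ∣bα∣≤r with suc (length α) <? r | length α <? r
  ... | yes ∣bα∣<r | yes ∣α∣<r = up (toInner c (length α) ∣α∣<r ∣bα∣<r (fromList α) b)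
  ... | no _ | yes ∣α∣<r = up (toQuasi c (length α) ∣α∣<r (fromList α) b _ (toList-subst _ (fromList (b ∷ α))))
  ... | _ | no ∣α∣≮r = ⊥-elim (∣α∣≮r (recompute (suc (length α) ≤? r) ∣bα∣≤r))

  ancestorWalk : ∀ c {α β} → α ⊑ β → .(∣β∣≤r : length β ≤ r) .(∣α∣≤r : length α ≤ r) →
                 Σ[ w ∈ Walk (vertexAt c β ∣β∣≤r) (vertexAt c α ∣α∣≤r) ] length α + len w ≡ length β
  ancestorWalk c (here α≈β) _ _ with Pointwise-≡⇒≡ α≈β
  ... | refl = [] , +-identityʳ _
  ancestorWalk c {α} (there {b} α⊑β) ∣bβ∣≤r ∣α∣≤r with ancestorWalk c α⊑β (≤-trans (n≤1+n _) ∣bβ∣≤r) ∣α∣≤r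
  ... | w , len-w = vertexAt-adj c b _ ∣bβ∣≤r ∷ w , trans (+-suc (length α) (len w)) (cong suc len-w)

  climbTo : ∀ c α .(∣α∣≤r : length α ≤ r) {u} → OnSide c u → α ⊑ addr u →
            Σ[ w ∈ Walk u (vertexAt c α ∣α∣≤r) ] length α + len w ≡ depth u
  climbTo c α ∣α∣≤r {u} u-side α⊑u with ancestorWalk c α⊑u (depth-≤ u) ∣α∣≤r
  ... | w , len-w = castʷ (vertexAt-addr c u u-side) refl w ,
                    trans (cong (length α +_) (len-castʷ (vertexAt-addr c u u-side) refl w)) len-w

  climb : ∀ c {u u′} → OnSide c u → OnSide c u′ → addr u′ ⊑ addr u → Σ[ w ∈ Walk u u′ ] depth u′ + len w ≡ depth u
  climb c {u} {u′} u-side u′-side u′⊑u with climbTo c (addr u′) (depth-≤ u′) u-side u′⊑u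
  ... | w , len-w = castʷ refl (vertexAt-addr c u′ u′-side) w ,
                    trans (cong (depth u′ +_) (len-castʷ refl (vertexAt-addr c u′ u′-side) w)) len-w

  viaAncestor : ∀ c α .(∣α∣≤r : length α ≤ r) {u y} → OnSide c u → OnSide c y → α ⊑ addr u → α ⊑ addr y →
                Σ[ w ∈ Walk u y ] length α + length α + len w ≡ depth u + depth y
  viaAncestor c α ∣α∣≤r {u} {y} u-side y-side α⊑u α⊑y
    with climbTo c α ∣α∣≤r u-side α⊑u | climbTo c α ∣α∣≤r y-side α⊑y
  ... | w₁ , len-w₁ | w₂ , len-w₂ = w₁ ++ʷ reverse w₂ , (begin
    length α + length α + len (w₁ ++ʷ reverse w₂)     ≡⟨ +-len-++ʷ (length α) (length α) w₁ (reverse w₂) ⟨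
    (length α + len w₁) + (length α + len (reverse w₂))
      ≡⟨ cong (λ n → (length α + len w₁) + (length α + n)) (len-reverse w₂) ⟩
    (length α + len w₁) + (length α + len w₂)           ≡⟨ cong₂ _+_ len-w₁ len-w₂ ⟩
    depth u + depth y                                   ∎)
    where open ≡-Reasoning

  exits-cone : ∀ γ {x y} (w : Walk x y) → γ ⊑ addr x → ¬ γ ⊑ addr y → Σ[ v ∈ GTVertex r ] v ∈ verts w × addr v ◁ γ
  exits-cone γ [] γ⊑x γ⋢y = ⊥-elim (γ⋢y γ⊑x)
  exits-cone γ (_∷_ {y = x₁} e w) γ⊑x γ⋢y with γ ⊑? addr x₁
  ... | yes γ⊑x₁ with exits-cone γ w γ⊑x₁ γ⋢y
  ...   | v , v∈w , v◁γ = v , there v∈w , v◁γ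
  exits-cone γ (_∷_ {y = x₁} e w) γ⊑x γ⋢y | no γ⋢x₁ with adj-addr e
  ... | inj₁ x◁x₁ = ⊥-elim (γ⋢x₁ (⊑-trans γ⊑x (⊑-◁ x◁x₁)))
  ... | inj₂ (b , x≡bx₁) with ⊑-∷⁻ (subst (γ ⊑_) x≡bx₁ γ⊑x)
  ...   | inj₁ γ≡bx₁ = x₁ , there (start∈verts w) , b , γ≡bx₁
  ...   | inj₂ γ⊑x₁ = ⊥-elim (γ⋢x₁ γ⊑x₁)

  mirror : GTVertex r → GTVertex r
  mirror (inner c d d<r a) = inner (not c) d d<r a
  mirror (quasi a) = quasi a

  mirror-involutive : ∀ u → mirror (mirror u) ≡ u
  mirror-involutive (inner false _ _ _) = refl
  mirror-involutive (inner true _ _ _) = refl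
  mirror-involutive (quasi _) = refl

  mirror-injective : ∀ {u v} → mirror u ≡ mirror v → u ≡ v
  mirror-injective {u} {v} eq = trans (sym (mirror-involutive u)) (trans (cong mirror eq) (mirror-involutive v))

  mirror-adj : ∀ {u v} → GTAdj r u v → GTAdj r (mirror u) (mirror v)
  mirror-adj (down (toInner c d p q a b)) = down (toInner (not c) d p q a b)
  mirror-adj (down (toQuasi c d p a b v eq)) = down (toQuasi (not c) d p a b v eq)
  mirror-adj (up (toInner c d p q a b)) = up (toInner (not c) d p q a b)
  mirror-adj (up (toQuasi c d p a b v eq)) = up (toQuasi (not c) d p a b v eq)

  addr-mirror : ∀ u → addr (mirror u) ≡ addr u
  addr-mirror (inner _ _ _ _) = refl
  addr-mirror (quasi _) = refl

  mirror-lower : ∀ u → ¬ level u ≤ r → level (mirror u) ≤ r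
  mirror-lower (inner false d d<r _) u≰r = ⊥-elim (u≰r (<⇒≤ (relevant d<r)))
  mirror-lower (inner true d d<r _) _ = <⇒≤ (relevant d<r)
  mirror-lower (quasi _) u≰r = ⊥-elim (u≰r ≤-refl)

module Cycle {r : ℕ} (i j : Vec Bool r) (φ : Fork (toList i) (toList j)) where

  open GT r
  open Glued r
  open Fork φ

  d₀ : ℕ
  d₀ = length stem

  stem⊑i : stem ⊑ toList i
  stem⊑i = ⊑-trans (there ⊑-refl) bitˡ∷stem⊑α

  stem⊑j : stem ⊑ toList j
  stem⊑j = ⊑-trans (there ⊑-refl) bitʳ∷stem⊑β

  d₀<r : d₀ < r
  d₀<r = subst (suc d₀ ≤_) (length-toList i) (⊑-length bitˡ∷stem⊑α)

  InCycle : GTVertex r → Set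
  InCycle z = (addr z ⊑ toList i ⊎ addr z ⊑ toList j) × d₀ ≤ depth z

  stem⊑ : ∀ {α} → α ⊑ toList j → d₀ ≤ length α → stem ⊑ α
  stem⊑ α⊑j = ⊑-comparable stem⊑j α⊑j

  off-i⇒⊑j : ∀ z → InCycle z → ¬ addr z ⊑ toList i → addr z ⊑ toList j
  off-i⇒⊑j _ (inj₁ z⊑i , _) z⋢i = ⊥-elim (z⋢i z⊑i)
  off-i⇒⊑j _ (inj₂ z⊑j , _) _ = z⊑j

  off-i⇒deeper : ∀ z → InCycle z → ¬ addr z ⊑ toList i → d₀ < depth z
  off-i⇒deeper z z-in z⋢i with m≤n⇒m<n∨m≡n (proj₂ z-in)
  ... | inj₁ d₀<z = d₀<z
  ... | inj₂ d₀≡z = ⊥-elim (z⋢i (subst (_⊑ toList i) (⊑-unique stem⊑j (off-i⇒⊑j z z-in z⋢i) d₀≡z) stem⊑i))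

  bitˡ∷stem⋢j : ∀ {α} → α ⊑ toList j → ¬ bitˡ ∷ stem ⊑ α
  bitˡ∷stem⋢j α⊑j ⊑α = bitˡ≢bitʳ (∷-injectiveˡ (⊑-unique (⊑-trans ⊑α α⊑j) bitʳ∷stem⊑β refl))

  stem-level : ∀ v → addr v ≡ stem → level v ≡ d₀ ⊎ level v + d₀ ≡ r + r
  stem-level v v≡stem with ≤-total (level v) r
  ... | inj₁ v≤r = inj₁ (trans (lower-level v v≤r) (cong length v≡stem))
  ... | inj₂ r≤v = inj₂ (trans (cong (λ α → level v + length α) (sym v≡stem)) (upper-level v r≤v))

  split-at-stem : ∀ {x y} (w : Walk x y) → addr x ⊑ toList i → d₀ < depth x → addr y ⊑ toList j →
                  Σ[ v ∈ GTVertex r ] Σ[ w₁ ∈ Walk x v ] Σ[ w₂ ∈ Walk v y ]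
                    w ≡ w₁ ++ʷ w₂ × (level v ≡ d₀ ⊎ level v + d₀ ≡ r + r)
  split-at-stem w x⊑i d₀<x y⊑j
    with exits-cone (bitˡ ∷ stem) w (⊑-comparable bitˡ∷stem⊑α x⊑i d₀<x) (bitˡ∷stem⋢j y⊑j)
  ... | v , v∈w , _ , v◁ with split-at w v∈w
  ... | w₁ , w₂ , w≡ = v , w₁ , w₂ , w≡ , stem-level v (sym (∷-injectiveʳ v◁))

  upper-below-top : ∀ v z → level v + d₀ ≡ r + r → r ≤ level z → d₀ ≤ depth z → level z ≤ level v
  upper-below-top v z top r≤z d₀≤z = +-cancelʳ-≤ (depth z) (level z) (level v) (begin
    level z + depth z ≡⟨ upper-level z r≤z ⟩
    r + r             ≡⟨ top ⟨
    level v + d₀      ≤⟨ +-monoʳ-≤ (level v) d₀≤z ⟩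
    level v + depth z ∎)
    where open ≤-Reasoning

  depth-from-level : ∀ z → d₀ ≤ level z → level z + d₀ ≤ r + r → d₀ ≤ depth z
  depth-from-level z d₀≤z z+d₀≤2r with ≤-total (level z) r
  ... | inj₁ z≤r = subst (d₀ ≤_) (lower-level z z≤r) d₀≤z
  ... | inj₂ r≤z = +-cancelˡ-≤ (level z) d₀ (depth z) (≤-trans z+d₀≤2r (≤-reflexive (sym (upper-level z r≤z))))

  depth-≤-leaf : ∀ z a → depth z ≤ depth (quasi a)
  depth-≤-leaf z a = ≤-trans (depth-≤ z) (≤-reflexive (sym (depth-quasi a)))

  leaf-to-leaf-len-≤ : (W : Walk (quasi i) (quasi j)) → IsShortest W → d₀ + d₀ + len W ≤ r + r
  leaf-to-leaf-len-≤ W shortest with viaAncestor false stem (<⇒≤ d₀<r) ≤-refl ≤-refl stem⊑i stem⊑j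
  ... | ref , len-ref = begin
    d₀ + d₀ + len W                   ≤⟨ +-monoʳ-≤ (d₀ + d₀) (shortest ref) ⟩
    d₀ + d₀ + len ref                 ≡⟨ len-ref ⟩
    depth (quasi i) + depth (quasi j) ≡⟨ cong₂ _+_ (depth-quasi i) (depth-quasi j) ⟩
    r + r                             ∎
    where open ≤-Reasoning

  onCycle⇒InCycle : ∀ {z} → OnCycle r i j z → InCycle z
  onCycle⇒InCycle {z} (W , shortest , z∈W)
    with split-at-stem W ⊑-refl (subst (d₀ <_) (sym (depth-quasi i)) d₀<r) ⊑-refl
  ... | v , w₁ , w₂ , refl , inj₁ v≡d₀ = on-branch z∈w , depth-from-level z d₀≤z z+d₀≤2r
    where
    z∈w = ∈-verts-++⁻ w₁ w₂ z∈W
    halves = valley w₁ w₂ (subst (λ h → h + h + len (w₁ ++ʷ w₂) ≤ r + r) (sym v≡d₀)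
                                 (leaf-to-leaf-len-≤ (w₁ ++ʷ w₂) shortest))
    between : z ∈ verts w₁ ⊎ z ∈ verts w₂ → level v ≤ level z × level z ≤ r
    between (inj₁ z∈w₁) = descending-range w₁ (proj₁ halves) z∈w₁
    between (inj₂ z∈w₂) = ascending-range w₂ (proj₂ halves) z∈w₂
    d₀≤z = subst (_≤ level z) v≡d₀ (proj₁ (between z∈w))
    z+d₀≤2r = +-mono-≤ (proj₂ (between z∈w)) (<⇒≤ d₀<r)
    on-branch : z ∈ verts w₁ ⊎ z ∈ verts w₂ → addr z ⊑ toList i ⊎ addr z ⊑ toList j
    on-branch (inj₁ z∈w₁) = inj₁ (descending-comparable w₁ (proj₁ halves) z∈w₁ (start∈verts w₁) (depth-≤-leaf z i))
    on-branch (inj₂ z∈w₂) = inj₂ (ascending-comparable w₂ (proj₂ halves) z∈w₂ (end∈verts w₂) (depth-≤-leaf z j))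
  ... | v , w₁ , w₂ , refl , inj₂ top = on-branch z∈w , depth-from-level z d₀≤z z+d₀≤2r
    where
    z∈w = ∈-verts-++⁻ w₁ w₂ z∈W
    halves = peak w₁ w₂ (reflect-≤ {level v} {d₀} {r} top (leaf-to-leaf-len-≤ (w₁ ++ʷ w₂) shortest))
    between : z ∈ verts w₁ ⊎ z ∈ verts w₂ → r ≤ level z × level z ≤ level v
    between (inj₁ z∈w₁) = ascending-range w₁ (proj₁ halves) z∈w₁
    between (inj₂ z∈w₂) = descending-range w₂ (proj₂ halves) z∈w₂
    d₀≤z = ≤-trans (<⇒≤ d₀<r) (proj₁ (between z∈w))
    z+d₀≤2r = ≤-trans (+-monoˡ-≤ d₀ (proj₂ (between z∈w))) (≤-reflexive top)
    on-branch : z ∈ verts w₁ ⊎ z ∈ verts w₂ → addr z ⊑ toList i ⊎ addr z ⊑ toList j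
    on-branch (inj₁ z∈w₁) = inj₁ (ascending-comparable w₁ (proj₁ halves) z∈w₁ (start∈verts w₁) (depth-≤-leaf z i))
    on-branch (inj₂ z∈w₂) = inj₂ (descending-comparable w₂ (proj₂ halves) z∈w₂ (end∈verts w₂) (depth-≤-leaf z j))

  Shallower : GTVertex r → GTVertex r → Set
  Shallower x y = InCycle y × depth y ≤ depth x

  module Deepest {x : GTVertex r} (x-lower : level x ≤ r) (x⊑i : addr x ⊑ toList i) (d₀≤x : d₀ ≤ depth x) where

    D : ℕ
    D = depth x

    level-x : level x ≡ D
    level-x = lower-level x x-lower

    stem⊑x : stem ⊑ addr x
    stem⊑x = ⊑-comparable stem⊑i x⊑i d₀≤x

    Shallow : GTVertex r → Set
    Shallow = Shallower x

    -- The position along C_{i,j} from x: up the i-branch of T⁽¹⁾, down its j-branch, up the j-branch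
    -- of T⁽²⁾ and down its i-branch, ordered lexicographically. Vertices deeper than x are skipped,
    -- so the truncated subtractions are exact.
    pos : GTVertex r → ℕ × ℕ
    pos z with level z ≤? r | addr z ⊑? toList i
    ... | yes _ | yes _ = 0 , D ∸ depth z
    ... | yes _ | no _  = 1 , depth z
    ... | no _  | no _  = 2 , D ∸ depth z
    ... | no _  | yes _ = 3 , depth z

    data PosView (z : GTVertex r) : ℕ × ℕ → Set where
      lower-i : level z ≤ r → addr z ⊑ toList i → PosView z (0 , D ∸ depth z)
      lower-j : level z ≤ r → ¬ addr z ⊑ toList i → PosView z (1 , depth z)
      upper-j : r < level z → ¬ addr z ⊑ toList i → PosView z (2 , D ∸ depth z)
      upper-i : r < level z → addr z ⊑ toList i → PosView z (3 , depth z)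

    posView : ∀ z → PosView z (pos z)
    posView z with level z ≤? r | addr z ⊑? toList i
    ... | yes z≤r | yes z⊑i = lower-i z≤r z⊑i
    ... | yes z≤r | no z⋢i  = lower-j z≤r z⋢i
    ... | no z≰r  | no z⋢i  = upper-j (≰⇒> z≰r) z⋢i
    ... | no z≰r  | yes z⊑i = upper-i (≰⇒> z≰r) z⊑i

    infix 4 _≺_

    _≺_ : ℕ × ℕ → ℕ × ℕ → Set
    _≺_ = ×-Lex _≡_ _<_ _<_

    pos-injective : ∀ {z z′} → Shallow z → Shallow z′ → pos z ≡ pos z′ → z ≡ z′
    pos-injective {z} {z′} (z-in , z≤D) (z′-in , z′≤D) = same (posView z) (posView z′)
      where
      same : ∀ {p p′} → PosView z p → PosView z′ p′ → p ≡ p′ → z ≡ z′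
      same (lower-i z≤r z⊑i) (lower-i z′≤r z′⊑i) eq =
        same-place false z≤r z′≤r z⊑i z′⊑i (∸-cancelˡ-≡ z≤D z′≤D (cong proj₂ eq))
      same (lower-j z≤r z⋢i) (lower-j z′≤r z′⋢i) eq =
        same-place false z≤r z′≤r (off-i⇒⊑j z z-in z⋢i) (off-i⇒⊑j z′ z′-in z′⋢i) (cong proj₂ eq)
      same (upper-j r<z z⋢i) (upper-j r<z′ z′⋢i) eq =
        same-place true (<⇒≤ r<z) (<⇒≤ r<z′) (off-i⇒⊑j z z-in z⋢i) (off-i⇒⊑j z′ z′-in z′⋢i)
                   (∸-cancelˡ-≡ z≤D z′≤D (cong proj₂ eq))
      same (upper-i r<z z⊑i) (upper-i r<z′ z′⊑i) eq = same-place true (<⇒≤ r<z) (<⇒≤ r<z′) z⊑i z′⊑i (cong proj₂ eq)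
      same (lower-i _ _) (lower-j _ _) ()
      same (lower-i _ _) (upper-j _ _) ()
      same (lower-i _ _) (upper-i _ _) ()
      same (lower-j _ _) (lower-i _ _) ()
      same (lower-j _ _) (upper-j _ _) ()
      same (lower-j _ _) (upper-i _ _) ()
      same (upper-j _ _) (lower-i _ _) ()
      same (upper-j _ _) (lower-j _ _) ()
      same (upper-j _ _) (upper-i _ _) ()
      same (upper-i _ _) (lower-i _ _) ()
      same (upper-i _ _) (lower-j _ _) ()
      same (upper-i _ _) (upper-j _ _) ()

    Before After : ∀ {y} → Walk x y → ℕ × ℕ → Set
    Before w p = ∀ {z q} → Shallow z → PosView z q → q ≺ p → z ∈ verts w
    After w p = ∀ {z q} → Shallow z → PosView z q → p ≺ q → z ∈ verts w

    lower-i-on-descent : ∀ {v z} (w : Walk x v) → Descending w → level v ≤ level z → level z ≤ r →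
                         addr z ⊑ toList i → depth z ≤ D → z ∈ verts w
    lower-i-on-descent {z = z} w desc v≤z z≤r z⊑i z≤D =
      descending-visits w desc v≤z (lower-level-mono z x z≤r x-lower z≤D) (start∈verts w) (⊑-comparable z⊑i x⊑i z≤D)

    upper-i-on-ascent : ∀ {v z} (w : Walk x v) → Ascending w → r < level z → level z ≤ level v →
                        addr z ⊑ toList i → depth z ≤ D → z ∈ verts w
    upper-i-on-ascent w asc r<z z≤v z⊑i z≤D =
      ascending-visits w asc (≤-trans x-lower (<⇒≤ r<z)) z≤v (start∈verts w) (⊑-comparable z⊑i x⊑i z≤D)

    len-≤-to-ancestor : ∀ {y} (w : Walk x y) → IsShortest w → level y ≤ r → addr y ⊑ addr x → depth y + len w ≤ D
    len-≤-to-ancestor w shortest y≤r y⊑x with climb false x-lower y≤r y⊑x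
    ... | ref , len-ref = ≤-trans (+-monoʳ-≤ _ (shortest ref)) (≤-reflexive len-ref)

    len-≤-through-low-stem : ∀ {y} (w : Walk x y) → IsShortest w → level y ≤ r → stem ⊑ addr y →
                             d₀ + d₀ + len w ≤ D + depth y
    len-≤-through-low-stem w shortest y≤r stem⊑y with viaAncestor false stem (<⇒≤ d₀<r) x-lower y≤r stem⊑x stem⊑y
    ... | ref , len-ref = ≤-trans (+-monoʳ-≤ (d₀ + d₀) (shortest ref)) (≤-reflexive len-ref)

    toLeaf : Σ[ w ∈ Walk x (quasi i) ] D + len w ≡ r
    toLeaf with climb false {quasi i} ≤-refl x-lower x⊑i
    ... | w , len-w = reverse w , trans (cong (D +_) (len-reverse w)) (trans len-w (depth-quasi i))

    len-≤-through-leaf : ∀ {y} (w : Walk x y) → IsShortest w → r ≤ level y → addr y ⊑ toList i →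
                         D + depth y + len w ≤ r + r
    len-≤-through-leaf {y} w shortest r≤y y⊑i with toLeaf | climb true {quasi i} ≤-refl r≤y y⊑i
    ... | w₁ , len-w₁ | w₂ , len-w₂ = begin
      D + depth y + len w               ≤⟨ +-monoʳ-≤ (D + depth y) (shortest (w₁ ++ʷ w₂)) ⟩
      D + depth y + len (w₁ ++ʷ w₂)     ≡⟨ +-len-++ʷ D (depth y) w₁ w₂ ⟨
      (D + len w₁) + (depth y + len w₂) ≡⟨ cong₂ _+_ len-w₁ (trans len-w₂ (depth-quasi i)) ⟩
      r + r                             ∎
      where open ≤-Reasoning

    len-≤-through-leaf-and-high-stem : ∀ {y} (w : Walk x y) → IsShortest w → r ≤ level y → stem ⊑ addr y →
                                       d₀ + d₀ + len w + D ≤ r + r + depth y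
    len-≤-through-leaf-and-high-stem {y} w shortest r≤y stem⊑y
      with toLeaf | viaAncestor true stem (<⇒≤ d₀<r) {quasi i} ≤-refl r≤y stem⊑i stem⊑y
    ... | w₁ , len-w₁ | w₂ , len-w₂ = begin
      d₀ + d₀ + len w + D               ≤⟨ +-monoˡ-≤ D (+-monoʳ-≤ (d₀ + d₀) (shortest (w₁ ++ʷ w₂))) ⟩
      d₀ + d₀ + len (w₁ ++ʷ w₂) + D     ≡⟨ +-comm _ D ⟩
      D + (d₀ + d₀ + len (w₁ ++ʷ w₂))   ≡⟨ +-assoc D (d₀ + d₀) _ ⟨
      D + (d₀ + d₀) + len (w₁ ++ʷ w₂)   ≡⟨ +-len-++ʷ D (d₀ + d₀) w₁ w₂ ⟨
      (D + len w₁) + (d₀ + d₀ + len w₂) ≡⟨ cong₂ _+_ len-w₁ (trans len-w₂ (cong (_+ depth y) (depth-quasi i))) ⟩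
      r + (r + depth y)                 ≡⟨ +-assoc r r (depth y) ⟨
      r + r + depth y                   ∎
      where open ≤-Reasoning

    covers-lower-i : ∀ {y} (w : Walk x y) → IsShortest w → level y ≤ r → addr y ⊑ toList i → depth y ≤ D →
                     Before w (0 , D ∸ depth y)
    covers-lower-i {y} w shortest y≤r y⊑i y≤D = visit
      where
      desc : Descending w
      desc = descending w (begin
        level y + len w ≡⟨ cong (_+ len w) (lower-level y y≤r) ⟩
        depth y + len w ≤⟨ len-≤-to-ancestor w shortest y≤r (⊑-comparable y⊑i x⊑i y≤D) ⟩
        D               ≡⟨ level-x ⟨
        level x         ∎)
        where open ≤-Reasoning

      visit : Before w (0 , D ∸ depth y)
      visit {z} (_ , z≤D) (lower-i z≤r z⊑i) (inj₂ (_ , z-offset<y)) =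
        lower-i-on-descent w desc (lower-level-mono y z y≤r z≤r (<⇒≤ (∸-cancelʳ-< z-offset<y))) z≤r z⊑i z≤D
      visit _ (lower-i _ _) (inj₁ ())
      visit _ (lower-j _ _) (inj₁ ())
      visit _ (lower-j _ _) (inj₂ (() , _))
      visit _ (upper-j _ _) (inj₁ ())
      visit _ (upper-j _ _) (inj₂ (() , _))
      visit _ (upper-i _ _) (inj₁ ())
      visit _ (upper-i _ _) (inj₂ (() , _))

    covers-upper-i : ∀ {y} (w : Walk x y) → IsShortest w → r < level y → addr y ⊑ toList i → After w (3 , depth y)
    covers-upper-i {y} w shortest r<y y⊑i = visit
      where
      asc : Ascending w
      asc = ascending w (+-cancelʳ-≤ (depth y) (level x + len w) (level y) (begin
        level x + len w + depth y ≡⟨ cong (λ h → h + len w + depth y) level-x ⟩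
        D + len w + depth y       ≡⟨ xy∙z≈xz∙y D (len w) (depth y) ⟩
        D + depth y + len w       ≤⟨ len-≤-through-leaf w shortest (<⇒≤ r<y) y⊑i ⟩
        r + r                     ≡⟨ upper-level y (<⇒≤ r<y) ⟨
        level y + depth y         ∎))
        where open ≤-Reasoning

      visit : After w (3 , depth y)
      visit {z} (_ , z≤D) (upper-i r<z z⊑i) (inj₂ (_ , y<z)) =
        upper-i-on-ascent w asc r<z (upper-level-anti y z (<⇒≤ r<y) (<⇒≤ r<z) (<⇒≤ y<z)) z⊑i z≤D
      visit _ (upper-i _ _) (inj₁ (s≤s (s≤s (s≤s ()))))
      visit _ (lower-i _ _) (inj₁ ())
      visit _ (lower-i _ _) (inj₂ (() , _))
      visit _ (lower-j _ _) (inj₁ (s≤s ()))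
      visit _ (lower-j _ _) (inj₂ (() , _))
      visit _ (upper-j _ _) (inj₁ (s≤s (s≤s ())))
      visit _ (upper-j _ _) (inj₂ (() , _))

    lower-j-through-low-stem : ∀ {v y} (w₁ : Walk x v) (w₂ : Walk v y) → IsShortest (w₁ ++ʷ w₂) →
                               level y ≤ r → addr y ⊑ toList j → d₀ < depth y → level v ≡ d₀ →
                               Before (w₁ ++ʷ w₂) (1 , depth y)
    lower-j-through-low-stem {v} {y} w₁ w₂ shortest y≤r y⊑j d₀<y v≡d₀ = visit
      where
      halves : Descending w₁ × Ascending w₂
      halves = valley w₁ w₂ (subst₂ (λ h l → h + h + len (w₁ ++ʷ w₂) ≤ l) (sym v≡d₀)
                                    (cong₂ _+_ (sym level-x) (sym (lower-level y y≤r)))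
                                    (len-≤-through-low-stem (w₁ ++ʷ w₂) shortest y≤r (stem⊑ y⊑j (<⇒≤ d₀<y))))

      v≤ : ∀ z → level z ≤ r → d₀ ≤ depth z → level v ≤ level z
      v≤ z z≤r d₀≤z = subst₂ _≤_ (sym v≡d₀) (sym (lower-level z z≤r)) d₀≤z

      visit : Before (w₁ ++ʷ w₂) (1 , depth y)
      visit {z} ((_ , d₀≤z) , z≤D) (lower-i z≤r z⊑i) _ =
        ∈-verts-++⁺ˡ w₁ w₂ (lower-i-on-descent w₁ (proj₁ halves) (v≤ z z≤r d₀≤z) z≤r z⊑i z≤D)
      visit {z} (z-in , _) (lower-j z≤r z⋢i) (inj₂ (_ , z<y)) =
        ∈-verts-++⁺ʳ w₁ w₂ (ascending-visits w₂ (proj₂ halves) (v≤ z z≤r (proj₂ z-in))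
                                             (lower-level-mono z y z≤r y≤r (<⇒≤ z<y)) (end∈verts w₂)
                                             (⊑-comparable (off-i⇒⊑j z z-in z⋢i) y⊑j (<⇒≤ z<y)))
      visit _ (lower-j _ _) (inj₁ (s≤s ()))
      visit _ (upper-j _ _) (inj₁ (s≤s ()))
      visit _ (upper-j _ _) (inj₂ (() , _))
      visit _ (upper-i _ _) (inj₁ (s≤s ()))
      visit _ (upper-i _ _) (inj₂ (() , _))

    lower-j-through-high-stem : ∀ {v y} (w₁ : Walk x v) (w₂ : Walk v y) → IsShortest (w₁ ++ʷ w₂) →
                                level y ≤ r → addr y ⊑ toList j → d₀ < depth y → level v + d₀ ≡ r + r →
                                After (w₁ ++ʷ w₂) (1 , depth y)
    lower-j-through-high-stem {v} {y} w₁ w₂ shortest y≤r y⊑j d₀<y top = visit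
      where
      ℓ = len (w₁ ++ʷ w₂)

      budget : d₀ + d₀ + ℓ ≤ D + depth y
      budget = len-≤-through-low-stem (w₁ ++ʷ w₂) shortest y≤r (stem⊑ y⊑j (<⇒≤ d₀<y))

      -- A geodesic through the stem vertex of T⁽²⁾ is no longer than the walk through the stem
      -- vertex of T⁽¹⁾ only when x and y are both quasi-leaves.
      2r≤D+y : r + r ≤ D + depth y
      2r≤D+y = +-double-cancel-≤ (begin
        (r + r) + (r + r)                     ≡⟨ cong₂ _+_ top top ⟨
        (level v + d₀) + (level v + d₀)       ≡⟨ interchange (level v) d₀ (level v) d₀ ⟩
        (level v + level v) + (d₀ + d₀)       ≤⟨ +-monoˡ-≤ (d₀ + d₀) (peak-bound w₁ w₂) ⟩
        (level x + level y + ℓ) + (d₀ + d₀)   ≡⟨ cong (λ l → l + ℓ + (d₀ + d₀)) x+y≡ ⟩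
        (D + depth y + ℓ) + (d₀ + d₀)         ≡⟨ +-shift (D + depth y) ℓ (d₀ + d₀) ⟩
        (D + depth y) + (d₀ + d₀ + ℓ)         ≤⟨ +-monoʳ-≤ (D + depth y) budget ⟩
        (D + depth y) + (D + depth y)         ∎)
        where
        open ≤-Reasoning
        x+y≡ : level x + level y ≡ D + depth y
        x+y≡ = cong₂ _+_ level-x (lower-level y y≤r)

      D≡r×y≡r : D ≡ r × depth y ≡ r
      D≡r×y≡r = +-tight (depth-≤ x) (depth-≤ y) 2r≤D+y

      halves : Ascending w₁ × Descending w₂
      halves = peak w₁ w₂ (subst (λ l → l + ℓ ≤ level v + level v) 2r≡x+y
                                 (reflect-≤ {level v} {d₀} {r} top (subst (d₀ + d₀ + ℓ ≤_) D+y≡2r budget)))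
        where
        D+y≡2r : D + depth y ≡ r + r
        D+y≡2r = cong₂ _+_ (proj₁ D≡r×y≡r) (proj₂ D≡r×y≡r)
        2r≡x+y : r + r ≡ level x + level y
        2r≡x+y = sym (trans (cong₂ _+_ level-x (lower-level y y≤r)) D+y≡2r)

      visit : After (w₁ ++ʷ w₂) (1 , depth y)
      visit (_ , z≤D) (lower-j _ _) (inj₂ (_ , y<z)) =
        ⊥-elim (<⇒≱ y<z (≤-trans z≤D (≤-reflexive (trans (proj₁ D≡r×y≡r) (sym (proj₂ D≡r×y≡r))))))
      visit {z} (z-in , _) (upper-j r<z z⋢i) _ =
        ∈-verts-++⁺ʳ w₁ w₂ (descending-visits w₂ (proj₂ halves) (≤-trans y≤r (<⇒≤ r<z))
                                              (upper-below-top v z top (<⇒≤ r<z) (proj₂ z-in)) (end∈verts w₂)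
                                              (⊑-comparable (off-i⇒⊑j z z-in z⋢i) y⊑j z≤y))
        where z≤y = ≤-trans (depth-≤ z) (≤-reflexive (sym (proj₂ D≡r×y≡r)))
      visit {z} (z-in , z≤D) (upper-i r<z z⊑i) _ =
        ∈-verts-++⁺ˡ w₁ w₂ (upper-i-on-ascent w₁ (proj₁ halves) r<z
                                              (upper-below-top v z top (<⇒≤ r<z) (proj₂ z-in)) z⊑i z≤D)
      visit _ (lower-j _ _) (inj₁ (s≤s ()))
      visit _ (lower-i _ _) (inj₁ ())
      visit _ (lower-i _ _) (inj₂ (() , _))

    upper-j-through-low-stem : ∀ {v y} (w₁ : Walk x v) (w₂ : Walk v y) → IsShortest (w₁ ++ʷ w₂) →
                               r < level y → addr y ⊑ toList j → d₀ < depth y → depth y ≤ D → level v ≡ d₀ →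
                               Before (w₁ ++ʷ w₂) (2 , D ∸ depth y)
    upper-j-through-low-stem {v} {y} w₁ w₂ shortest r<y y⊑j d₀<y y≤D v≡d₀ = visit
      where
      ℓ = len (w₁ ++ʷ w₂)
      r≤y = <⇒≤ r<y

      budget : d₀ + d₀ + ℓ + D ≤ r + r + depth y
      budget = len-≤-through-leaf-and-high-stem (w₁ ++ʷ w₂) shortest r≤y (stem⊑ y⊑j (<⇒≤ d₀<y))

      valley-sum : D + level y ≤ d₀ + d₀ + ℓ
      valley-sum = subst₂ (λ a h → a + level y ≤ h + h + ℓ) level-x v≡d₀ (valley-bound w₁ w₂)

      -- A geodesic through the stem vertex of T⁽¹⁾ is no longer than the walk through v_i and the
      -- stem vertex of T⁽²⁾ only when y is as deep as x.
      D≡y : D ≡ depth y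
      D≡y = ≤-antisym (+-double-cancel-≤ (+-cancelʳ-≤ (r + r) (D + D) (depth y + depth y) (begin
        (D + D) + (r + r)               ≡⟨ cong ((D + D) +_) (upper-level y r≤y) ⟨
        (D + D) + (level y + depth y)   ≡⟨ interchange D D (level y) (depth y) ⟩
        (D + level y) + (D + depth y)   ≤⟨ +-monoˡ-≤ (D + depth y) valley-sum ⟩
        (d₀ + d₀ + ℓ) + (D + depth y)   ≡⟨ +-assoc (d₀ + d₀ + ℓ) D (depth y) ⟨
        (d₀ + d₀ + ℓ + D) + depth y     ≤⟨ +-monoˡ-≤ (depth y) budget ⟩
        (r + r + depth y) + depth y     ≡⟨ +-assoc (r + r) (depth y) (depth y) ⟩
        (r + r) + (depth y + depth y)   ≡⟨ +-comm (r + r) _ ⟩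
        (depth y + depth y) + (r + r)   ∎))) y≤D
        where open ≤-Reasoning

      halves : Descending w₁ × Ascending w₂
      halves = valley w₁ w₂ (subst₂ (λ h a → h + h + ℓ ≤ a + level y) (sym v≡d₀) (sym level-x) (begin
        d₀ + d₀ + ℓ         ≤⟨ +-cancelʳ-≤ D _ _ (≤-trans budget (≤-reflexive (cong (r + r +_) (sym D≡y)))) ⟩
        r + r               ≡⟨ upper-level y r≤y ⟨
        level y + depth y   ≡⟨ cong (level y +_) D≡y ⟨
        level y + D         ≡⟨ +-comm (level y) D ⟩
        D + level y         ∎))
        where open ≤-Reasoning

      v≤ : ∀ z → level z ≤ r → d₀ ≤ depth z → level v ≤ level z
      v≤ z z≤r d₀≤z = subst₂ _≤_ (sym v≡d₀) (sym (lower-level z z≤r)) d₀≤z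

      visit : Before (w₁ ++ʷ w₂) (2 , D ∸ depth y)
      visit {z} ((_ , d₀≤z) , z≤D) (lower-i z≤r z⊑i) _ =
        ∈-verts-++⁺ˡ w₁ w₂ (lower-i-on-descent w₁ (proj₁ halves) (v≤ z z≤r d₀≤z) z≤r z⊑i z≤D)
      visit {z} (z-in , z≤D) (lower-j z≤r z⋢i) _ =
        ∈-verts-++⁺ʳ w₁ w₂ (ascending-visits w₂ (proj₂ halves) (v≤ z z≤r (proj₂ z-in)) (≤-trans z≤r r≤y)
                                             (end∈verts w₂)
                                             (⊑-comparable (off-i⇒⊑j z z-in z⋢i) y⊑j (≤-trans z≤D (≤-reflexive D≡y))))
      visit {z} _ (upper-j _ _) (inj₂ (_ , z-offset<y)) =
        ⊥-elim (n≮0 (subst (D ∸ depth z <_) (trans (cong (_∸ depth y) D≡y) (n∸n≡0 (depth y))) z-offset<y))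
      visit _ (upper-j _ _) (inj₁ (s≤s (s≤s ())))
      visit _ (upper-i _ _) (inj₁ (s≤s (s≤s ())))
      visit _ (upper-i _ _) (inj₂ (() , _))

    upper-j-through-high-stem : ∀ {v y} (w₁ : Walk x v) (w₂ : Walk v y) → IsShortest (w₁ ++ʷ w₂) →
                                r < level y → addr y ⊑ toList j → d₀ < depth y → level v + d₀ ≡ r + r →
                                After (w₁ ++ʷ w₂) (2 , D ∸ depth y)
    upper-j-through-high-stem {v} {y} w₁ w₂ shortest r<y y⊑j d₀<y top = visit
      where
      ℓ = len (w₁ ++ʷ w₂)
      r≤y = <⇒≤ r<y

      shuffle : ∀ a b c d → a + b + c + d ≡ d + c + a + b
      shuffle = solve-∀

      halves : Ascending w₁ × Descending w₂
      halves = peak w₁ w₂ (+-cancelʳ-≤ (d₀ + d₀) _ _ (begin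
        level x + level y + ℓ + (d₀ + d₀) ≡⟨ cong (λ a → a + level y + ℓ + (d₀ + d₀)) level-x ⟩
        D + level y + ℓ + (d₀ + d₀)       ≡⟨ shuffle D (level y) ℓ (d₀ + d₀) ⟩
        (d₀ + d₀ + ℓ + D) + level y       ≤⟨ +-monoˡ-≤ (level y) budget ⟩
        (r + r + depth y) + level y       ≡⟨ +-assoc (r + r) (depth y) (level y) ⟩
        (r + r) + (depth y + level y)     ≡⟨ cong (r + r +_) (+-comm (depth y) (level y)) ⟩
        (r + r) + (level y + depth y)     ≡⟨ cong (r + r +_) (upper-level y r≤y) ⟩
        (r + r) + (r + r)                 ≡⟨ cong₂ _+_ top top ⟨
        (level v + d₀) + (level v + d₀)   ≡⟨ interchange (level v) d₀ (level v) d₀ ⟩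
        level v + level v + (d₀ + d₀)     ∎))
        where
        open ≤-Reasoning
        budget = len-≤-through-leaf-and-high-stem (w₁ ++ʷ w₂) shortest r≤y (stem⊑ y⊑j (<⇒≤ d₀<y))

      visit : After (w₁ ++ʷ w₂) (2 , D ∸ depth y)
      visit {z} (z-in , _) (upper-j r<z z⋢i) (inj₂ (_ , y-offset<z)) =
        ∈-verts-++⁺ʳ w₁ w₂ (descending-visits w₂ (proj₂ halves) (upper-level-anti z y (<⇒≤ r<z) r≤y (<⇒≤ z<y))
                                              (upper-below-top v z top (<⇒≤ r<z) (proj₂ z-in)) (end∈verts w₂)
                                              (⊑-comparable (off-i⇒⊑j z z-in z⋢i) y⊑j (<⇒≤ z<y)))
        where z<y = ∸-cancelʳ-< y-offset<z
      visit {z} (z-in , z≤D) (upper-i r<z z⊑i) _ =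
        ∈-verts-++⁺ˡ w₁ w₂ (upper-i-on-ascent w₁ (proj₁ halves) r<z
                                              (upper-below-top v z top (<⇒≤ r<z) (proj₂ z-in)) z⊑i z≤D)
      visit _ (upper-j _ _) (inj₁ (s≤s (s≤s ())))
      visit _ (lower-i _ _) (inj₁ ())
      visit _ (lower-i _ _) (inj₂ (() , _))
      visit _ (lower-j _ _) (inj₁ (s≤s ()))
      visit _ (lower-j _ _) (inj₂ (() , _))

    covers-lower-j : ∀ {y} (w : Walk x y) → IsShortest w → level y ≤ r → ¬ addr y ⊑ toList i → Shallow y →
                     Before w (1 , depth y) ⊎ After w (1 , depth y)
    covers-lower-j {y} w shortest y≤r y⋢i (y-in , y≤D)
      with off-i⇒⊑j y y-in y⋢i | off-i⇒deeper y y-in y⋢i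
    ... | y⊑j | d₀<y with split-at-stem w x⊑i (<-≤-trans d₀<y y≤D) y⊑j
    ... | _ , w₁ , w₂ , refl , inj₁ low = inj₁ (lower-j-through-low-stem w₁ w₂ shortest y≤r y⊑j d₀<y low)
    ... | _ , w₁ , w₂ , refl , inj₂ top = inj₂ (lower-j-through-high-stem w₁ w₂ shortest y≤r y⊑j d₀<y top)

    covers-upper-j : ∀ {y} (w : Walk x y) → IsShortest w → r < level y → ¬ addr y ⊑ toList i → Shallow y →
                     Before w (2 , D ∸ depth y) ⊎ After w (2 , D ∸ depth y)
    covers-upper-j {y} w shortest r<y y⋢i (y-in , y≤D)
      with off-i⇒⊑j y y-in y⋢i | off-i⇒deeper y y-in y⋢i
    ... | y⊑j | d₀<y with split-at-stem w x⊑i (<-≤-trans d₀<y y≤D) y⊑j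
    ... | _ , w₁ , w₂ , refl , inj₁ low = inj₁ (upper-j-through-low-stem w₁ w₂ shortest r<y y⊑j d₀<y y≤D low)
    ... | _ , w₁ , w₂ , refl , inj₂ top = inj₂ (upper-j-through-high-stem w₁ w₂ shortest r<y y⊑j d₀<y top)

    geodesic-covers : ∀ {y} (w : Walk x y) → IsShortest w → Shallow y → Before w (pos y) ⊎ After w (pos y)
    geodesic-covers {y} w shortest y-shallow = by-position (posView y)
      where
      by-position : ∀ {p} → PosView y p → Before w p ⊎ After w p
      by-position (lower-i y≤r y⊑i) = inj₁ (covers-lower-i w shortest y≤r y⊑i (proj₂ y-shallow))
      by-position (lower-j y≤r y⋢i) = covers-lower-j w shortest y≤r y⋢i y-shallow
      by-position (upper-j r<y y⋢i) = covers-upper-j w shortest r<y y⋢i y-shallow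
      by-position (upper-i r<y y⊑i) = inj₂ (covers-upper-i w shortest r<y y⊑i)

    ≺-irrefl : ∀ {p} → ¬ p ≺ p
    ≺-irrefl = ×-irreflexive {_≈₁_ = _≡_} {_<₁_ = _<_} {_<₂_ = _<_} <-irrefl <-irrefl (refl , refl)

    ≺-compare : Trichotomous (Pointwise _≡_ _≡_) _≺_
    ≺-compare = ×-compare sym <-cmp <-cmp

    Candidate : (GTVertex r → Set) → GTVertex r → Set
    Candidate S z = S z × Shallow z × x ≢ z

    middle-hidden : ∀ {S} → MutualVisibility S → S x → ∀ {u y v} → Candidate S u → Candidate S y → Candidate S v →
                    pos u ≺ pos y → pos y ≺ pos v → ⊥
    middle-hidden mv Sx {u} {y} {v} (Su , u-shallow , x≢u) (Sy , y-shallow , _) (Sv , v-shallow , x≢v) u≺y y≺v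
      with mv x y Sx Sy
    ... | w , shortest , free with geodesic-covers w shortest y-shallow
    ... | inj₁ before =
      All.lookup free (∈-interior w (before u-shallow (posView u) u≺y) (≢-sym x≢u) (λ { refl → ≺-irrefl u≺y })) Su
    ... | inj₂ after =
      All.lookup free (∈-interior w (after v-shallow (posView v) y≺v) (≢-sym x≢v) (λ { refl → ≺-irrefl y≺v })) Sv

    pos-apart : ∀ {z z′} → Shallow z → Shallow z′ → z ≢ z′ → ¬ Pointwise _≡_ _≡_ (pos z) (pos z′)
    pos-apart z-shallow z′-shallow z≢z′ same = z≢z′ (pos-injective z-shallow z′-shallow (≡×≡⇒≡ same))

    no-three-shallower : ∀ {S} → MutualVisibility S → S x → ∀ {y₁ y₂ y₃} → Unique (x ∷ y₁ ∷ y₂ ∷ y₃ ∷ []) →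
                         All (λ y → S y × Shallow y) (y₁ ∷ y₂ ∷ y₃ ∷ []) → ⊥
    no-three-shallower {S} mv Sx {y₁} {y₂} {y₃}
                       ((x≢y₁ ∷ x≢y₂ ∷ x≢y₃ ∷ []) ∷ (y₁≢y₂ ∷ y₁≢y₃ ∷ []) ∷ (y₂≢y₃ ∷ []) ∷ [] ∷ [])
                       ((S₁ , sh₁) ∷ (S₂ , sh₂) ∷ (S₃ , sh₃) ∷ [])
      with middle-of-three ≺-compare pos {Candidate S} {y₁} {y₂} {y₃}
                           (S₁ , sh₁ , x≢y₁) (S₂ , sh₂ , x≢y₂) (S₃ , sh₃ , x≢y₃)
                           (pos-apart sh₁ sh₂ y₁≢y₂) (pos-apart sh₁ sh₃ y₁≢y₃) (pos-apart sh₂ sh₃ y₂≢y₃)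
    ... | _ , _ , _ , cu , cy , cv , u≺y , y≺v = middle-hidden mv Sx cu cy cv u≺y y≺v

module Reduction {r : ℕ} {i j : Vec Bool r} (φ : Fork (toList i) (toList j)) where

  open GT r
  open Glued r
  open Cycle i j φ

  no-three-shallower-lower : ∀ {S x y₁ y₂ y₃} → MutualVisibility S → level x ≤ r → S x → InCycle x →
                             Unique (x ∷ y₁ ∷ y₂ ∷ y₃ ∷ []) → All (λ y → S y × Shallower x y) (y₁ ∷ y₂ ∷ y₃ ∷ []) → ⊥
  no-three-shallower-lower {x = x} mv x≤r Sx (x-branch , d₀≤x) unique ys with addr x ⊑? toList i
  ... | yes x⊑i = Deepest.no-three-shallower x≤r x⊑i d₀≤x mv Sx unique ys
  ... | no x⋢i = Cycle.Deepest.no-three-shallower j i (Fork-swap φ) x≤r (x⊑j x-branch) d₀≤x mv Sx unique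
                                                    (All.map (Product.map₂ (Product.map₁ (Product.map₁ Sum.swap))) ys)
    where
    x⊑j : addr x ⊑ toList i ⊎ addr x ⊑ toList j → addr x ⊑ toList j
    x⊑j (inj₁ x⊑i) = ⊥-elim (x⋢i x⊑i)
    x⊑j (inj₂ x⊑j) = x⊑j

  InCycle-mirror : ∀ z → InCycle z → InCycle (mirror z)
  InCycle-mirror z = subst (λ α → (α ⊑ toList i ⊎ α ⊑ toList j) × d₀ ≤ length α) (sym (addr-mirror z))

  Shallower-mirror : ∀ x y → Shallower x y → Shallower (mirror x) (mirror y)
  Shallower-mirror x y (y-in , y≤x) =
    InCycle-mirror y y-in , subst₂ (λ α β → length β ≤ length α) (sym (addr-mirror x)) (sym (addr-mirror y)) y≤x

  no-three-shallower : ∀ {S x y₁ y₂ y₃} → MutualVisibility S → S x → InCycle x →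
                       Unique (x ∷ y₁ ∷ y₂ ∷ y₃ ∷ []) → All (λ y → S y × Shallower x y) (y₁ ∷ y₂ ∷ y₃ ∷ []) → ⊥
  no-three-shallower {S} {x} mv Sx x-in unique ys with level x ≤? r
  ... | yes x≤r = no-three-shallower-lower mv x≤r Sx x-in unique ys
  ... | no x≰r =
    no-three-shallower-lower (MutualVisibility-∘ mirror mirror-adj mirror-involutive mv) (mirror-lower x x≰r)
                             (subst S (sym (mirror-involutive x)) Sx) (InCycle-mirror x x-in)
                             (Unique.map⁺ mirror-injective unique) (All.map⁺ (All.map mirrored ys))
    where
    mirrored : ∀ {y} → S y × Shallower x y → S (mirror (mirror y)) × Shallower (mirror x) (mirror y)
    mirrored {y} (Sy , y-shallower) = subst S (sym (mirror-involutive y)) Sy , Shallower-mirror x y y-shallower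

  no-four-on-cycle : ∀ {S a b c d} → MutualVisibility S → Unique (a ∷ b ∷ c ∷ d ∷ []) →
                     All (λ z → S z × InCycle z) (a ∷ b ∷ c ∷ d ∷ []) → ⊥
  no-four-on-cycle mv unique onCycle with maximum-first depth unique onCycle
  ... | _ , _ , _ , _ , unique′ , (Sx , x-in) , ys =
    no-three-shallower mv Sx x-in unique′ (All.map (λ ((Sy , y-in) , y≤x) → Sy , y-in , y≤x) ys)

mainTheorem3 : (r : ℕ) → 1 ≤ r → (S : GTVertex r → Set) →
    GT.MutualVisibility r S →
    (i j : Vec Bool r) → i ≢ j →
    (xs : List (GTVertex r)) → Unique xs →
    All (λ x → S x × OnCycle r i j x) xs →
    length xs ≤ 3
mainTheorem3 r _ S mv i j i≢j xs unique members =
  at-most-three (Reduction.no-four-on-cycle φ mv) xs unique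
                (All.map (Product.map₂ (Cycle.onCycle⇒InCycle i j φ)) members)
  where
  φ : Fork (toList i) (toList j)
  φ = fork (toList i) (toList j) (trans (length-toList i) (sym (length-toList j))) (i≢j ∘ Vec-toList-injective)
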